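{- Let $c_s>0$ be a constant and let $S$ be a deterministic subset sum algorithm that, for every $N$, solves at least a $\frac{1}{\log^{c_s}N}$ fraction of the legal subset sum inputs with parameter $N$. There exists a constant $c_m$ such that for any integer $q<\frac{N}{\log^{c_m}N}$ there exists a matching $f$ among the $2\log^{c_m}N$ matchings $f^1_q,f^1_{2q},\dots,f^1_{\log^{c_m}N\cdot q},f^2_q,f^2_{2q},\dots,f^2_{\log^{c_m}N\cdot q}$ such that, with probability at least $\frac{1}{\log^{c_m}N}$ over the choice of $A=(a_1,\dots,a_r)$ uniform in $\{0,\dots,N-1\}^r$, the intersection of $f$ and $S(A)$ has size at least $\frac{N}{\log^{c_m}N}$.
   Context: Subset sum with parameter $N$: an input is $A=(a_1,\dots,a_r)$, $a_i\in\{0,\dots,N-1\}$, and $t\in\{0,\dots,N-1\}$, with $r=\log_2 N+4$; an output is $B\subseteq\{1,\dots,r\}$ with $\sum_{i\in B}a_i\equiv t\pmod N$; $(A,t)$ is legal if such $B$ exists. $S$ returns either such $B$ (denoted $S(A,t)$) or "error"; it solves a $\delta$ fraction of legal inputs if for uniformly random legal $(A,t)$ it returns a set with probability at least $\delta$. $S(A)=\{t: S(A,t)\ne\text{error}\}$. A partial function $f:\{0,\dots,N-1\}\to\{0,\dots,N-1\}$ is a matching if whenever $f(i)$ is defined, $f(i)\ne i$ and $f(f(i))=i$; it is a $q$-matching if moreover $|f(i)-i|=q$ whenever defined. The intersection of a matching $f$ and a set $T$ is $\{i: i\in T,\ f(i)\in T\}$. For integer $q\ge1$: $f^1_q(t)=t+q$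 if $t\bmod 2q<q$ and $t+q<N$; $f^1_q(t)=t-q$ if $t\bmod 2q\ge q$ and $t-q\ge0$; undefined otherwise. $f^2_q(t)=t-q$ if $t\bmod 2q<q$ and $t-q\ge0$; $f^2_q(t)=t+q$ if $t\bmod 2q\ge q$ and $t+q<N$; undefined otherwise. -}

module Defs where

open import Data.Bool using (Bool; true; false; if_then_else_; _∧_)
open import Data.Nat using (ℕ; zero; suc; _+_; _*_; _∸_; _^_; _<ᵇ_; _≤ᵇ_; _<?_)
open import Data.Nat.DivMod using (_%_)
open import Data.Nat.Logarithm using (⌊log₂_⌋)
open import Data.Fin using (Fin; toℕ; fromℕ<)
open import Data.Fin.Subset using (Subset; inside; outside)
open import Data.Fin.Subset.Properties using (anySubset?)
open import Data.Vec using (Vec; []; _∷_)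
open import Data.List using (List; length; filter; filterᵇ; concatMap; map; upTo; allFin; [_])
open import Data.Maybe using (Maybe; just; nothing; is-just; maybe)
open import Data.Product using (∃; Σ; _,_)
open import Relation.Binary.PropositionalEquality using (_≡_)
open import Relation.Nullary using (Dec; yes; no)
open import Data.Nat.Properties using (_≟_)

r : ℕ → ℕ
r N = ⌊log₂ N ⌋ + 4

Input : ℕ → Set
Input N = Vec (Fin N) (r N)

subsetSum : ∀ {N n} → Vec (Fin N) n → Subset n → ℕ
subsetSum []       []            = 0
subsetSum (a ∷ as) (inside ∷ B)  = toℕ a + subsetSum as B
subsetSum (a ∷ as) (outside ∷ B) = subsetSum as B

Solves : ∀ {N} → Input N → Fin N → Subset (r N) → Set
Solves {N} A t B = subsetSum A B % suc (N ∸ 1) ≡ toℕ t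
-- (N ≥ 1 whenever Fin N is inhabited, so suc (N ∸ 1) = N in all relevant cases)

Legal : ∀ {N} → Input N → Fin N → Set
Legal A t = ∃ λ B → Solves A t B

Legal? : ∀ {N} (A : Input N) (t : Fin N) → Dec (Legal A t)
Legal? A t = anySubset? (λ B → _ ≟ _)

-- a deterministic subset sum algorithm: returns just B, or nothing (= "error")
SubsetSumAlg : Set
SubsetSumAlg = (N : ℕ) → Input N → Fin N → Maybe (Subset (r N))

Correct : SubsetSumAlg → Set
Correct S = ∀ N (A : Input N) (t : Fin N) (B : Subset (r N)) → S N A t ≡ just B → Solves A t B

allVecs : (N n : ℕ) → List (Vec (Fin N) n)
allVecs N zero    = [ [] ]
allVecs N (suc n) = concatMap (λ x → map (x ∷_) (allVecs N n)) (allFin N)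

allInputs : (N : ℕ) → List (Σ (Input N) λ _ → Fin N)
allInputs N = concatMap (λ A → map (λ t → (A , t)) (allFin N)) (allVecs N (r N))

#legal : ℕ → ℕ
#legal N = length (filter (λ { (A , t) → Legal? A t }) (allInputs N))

#solved : SubsetSumAlg → ℕ → ℕ
#solved S N = length (filter (λ { (A , t) → Legal? A t })
                (filterᵇ (λ { (A , t) → is-just (S N A t) }) (allInputs N)))

SolvesFraction : SubsetSumAlg → (ℕ → ℕ) → ℕ → ℕ → Set
SolvesFraction S lg c N = #legal N Data.Nat.≤ #solved S N * lg N ^ c

-- membership of t ∈ ℕ in S(A) = { t : S(A,t) ≠ error }
inS : SubsetSumAlg → (N : ℕ) → Input N → ℕ → Bool
inS S N A t with t <? N
... | yes p = is-just (S N A (fromℕ< p))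
... | no _  = false

Matching : Set
Matching = ℕ → Maybe ℕ

-- f^1_q  (q ≥ 1; for q = 0 undefined everywhere, never used)
f¹ : ℕ → ℕ → Matching
f¹ N zero t = nothing
f¹ N q@(suc _) t =
  if t % (2 * q) <ᵇ q
  then (if t + q <ᵇ N then just (t + q) else nothing)
  else (if q ≤ᵇ t then just (t ∸ q) else nothing)

f² : ℕ → ℕ → Matching
f² N zero t = nothing
f² N q@(suc _) t =
  if t % (2 * q) <ᵇ q
  then (if q ≤ᵇ t then just (t ∸ q) else nothing)
  else (if t + q <ᵇ N then just (t + q) else nothing)

#intersection : ℕ → Matching → (ℕ → Bool) → ℕ
#intersection N f T = length (filterᵇ (λ i → T i ∧ maybe T false (f i)) (upTo N))

#goodA : SubsetSumAlg → ℕ → Matching → ℕ → ℕ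
#goodA S N f L = length (filterᵇ (λ A → N ≤ᵇ #intersection N f (inS S N A) * L) (allVecs N (r N)))

Good : SubsetSumAlg → ℕ → Matching → ℕ → Set
Good S N f L = N ^ r N Data.Nat.≤ #goodA S N f L * L

{-# OPTIONS --safe #-}
module Submission where

open import Defs
open import Data.Nat using (ℕ; _≤_; _<_; _*_; _^_)
open import Data.Nat.Logarithm using (⌊log₂_⌋; ⌈log₂_⌉)
open import Data.Product using (∃-syntax; _×_)
open import Data.Sum using (_⊎_)

open import Data.Nat
open import Data.Nat.Properties
open import Algebra.Properties.CommutativeSemigroup +-commutativeSemigroup using (interchange)
open import Data.Bool using (Bool; true; false; _∧_; _∨_; T)
open import Data.Bool.Properties using (∧-zeroʳ)
open import Data.Fin using (Fin; toℕ) renaming (zero to fzero; suc to fsuc)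
open import Data.Fin.Properties using (toℕ<n; fromℕ<-toℕ)
open import Data.Fin.Subset using (inside; outside; ⊥)
open import Data.List using (List; []; _∷_; length; filter; filterᵇ; concatMap; map; upTo; applyUpTo; allFin; tabulate; _++_)
open import Data.List.Properties using (length-map; length-++)
import Data.List.Properties as List
open import Data.List.Membership.Propositional using (_∈_)
open import Data.List.Membership.Propositional.Properties using (∈-++⁻; ∈-map⁻)
open import Data.List.Membership.DecPropositional _≟_ using (_∈?_)
open import Data.List.Relation.Unary.All using (All; []; _∷_; universal)
open import Data.List.Relation.Unary.All.Properties using (map⁺; ++⁺)
open import Data.List.Relation.Unary.Any using (here; there)
open import Data.Maybe using (just; is-just; maybe)
open import Data.Nat.DivMod
open import Data.Nat.Induction using (<-wellFounded)
open import Data.Nat.Logarithm using (⌊log₂⌋-mono-≤; ⌊log₂[2^n]⌋≡n; ⌈log₂⌉-mono-≤; ⌈log₂2^n⌉≡n)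
open import Data.Nat.Logarithm.Core using (⌊log2⌋)
open import Data.Nat.Tactic.RingSolver using (solve-∀)
open import Data.Product using (Σ; ∃; _,_)
open import Data.Sum using (inj₁; inj₂)
open import Data.Vec using (Vec; []; _∷_)
open import Function using (id; _∘_)
open import Induction.WellFounded using (Acc; acc)
open import Relation.Binary.PropositionalEquality
open import Relation.Nullary using (Dec; does; yes; no; ¬_; contradiction)
open import Relation.Unary using (Pred; Decidable)

-- Write k = ⌊log₂ N⌋ and r = k + 4. The 2^k subset sums of the first k entries of A collide
-- in at most 4^k / 2N ≤ 2^k / 2 pairs on average over A, so on average they hit at least
-- 2^(k-1) ≥ N / 4 residues, and a quarter of all pairs (A, t) are legal. Hence S answers on
-- N^(r+1) / (4 ⌈log₂ N⌉^cs) pairs, and by a Markov argument at least N^r / K inputs A have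
-- |S(A)| ≥ N / K, where K = 8 ⌈log₂ N⌉^cs.
--
-- Let U = S(A) be such a dense set and W(s) = #{i ≤ L : s − i q ∈ U}. Then Σ W = (L+1) |U|
-- while Σ W² ≤ (L+1) (|U| + 2 Σ_{1≤j≤L} |U ∩ (U − j q)|), so by Cauchy–Schwarz the overlaps
-- |U ∩ (U − j q)| are large on average. A pair t, t + j q ∈ U is an edge of f¹_{jq} or of
-- f²_{jq}, so at least 2K of these 2L matchings meet U in at least N / L points. Summing over A,
-- the pairs (A, matching) with a large intersection number at least 2 N^r, so one of the 2L
-- matchings has a large intersection for N^r / L inputs. The constants fit once
-- L = ⌊log₂ N⌋^(1 + 6 cs) ≥ 16 K² (K + 1), which holds for ⌊log₂ N⌋ ≥ 9216.

𝟙 : Bool → ℕ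
𝟙 true  = 1
𝟙 false = 0

𝟙≤1 : ∀ b → 𝟙 b ≤ 1
𝟙≤1 true  = ≤-refl
𝟙≤1 false = z≤n

𝟙-T : ∀ {b} → T b → 𝟙 b ≡ 1
𝟙-T {true} _ = refl

𝟙-∨ : ∀ a b → ¬ (T a × T b) → 𝟙 (a ∨ b) ≡ 𝟙 a + 𝟙 b
𝟙-∨ true  true  not-both = contradiction (_ , _) not-both
𝟙-∨ true  false _        = refl
𝟙-∨ false b     _        = refl

𝟙≤𝟙-∨ˡ : ∀ a b → 𝟙 b ≤ 𝟙 (a ∨ b)
𝟙≤𝟙-∨ˡ true  b = 𝟙≤1 b
𝟙≤𝟙-∨ˡ false b = ≤-refl

𝟙-does-mono : ∀ {a b} {A : Set a} {B : Set b} (A? : Dec A) (B? : Dec B) → (A → B) → 𝟙 (does A?) ≤ 𝟙 (does B?)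
𝟙-does-mono (yes a) (yes _) _   = ≤-refl
𝟙-does-mono (yes a) (no ¬b) A→B = contradiction (A→B a) ¬b
𝟙-does-mono (no _)  B?      _   = z≤n

𝟙-∧ : ∀ a b → 𝟙 (a ∧ b) ≡ 𝟙 a * 𝟙 b
𝟙-∧ true  b = sym (+-identityʳ (𝟙 b))
𝟙-∧ false b = refl

𝟙-∧≤ˡ : ∀ a b → 𝟙 (a ∧ b) ≤ 𝟙 a
𝟙-∧≤ˡ true  b = 𝟙≤1 b
𝟙-∧≤ˡ false b = z≤n

≤ᵇ-true : ∀ {m n} → m ≤ n → (m ≤ᵇ n) ≡ true
≤ᵇ-true {m} {n} m≤n with m ≤ᵇ n in m≤?n
... | true  = refl
... | false = contradiction (≤⇒≤ᵇ m≤n) (subst T m≤?n)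

≤ᵇ-false : ∀ {m n} → n < m → (m ≤ᵇ n) ≡ false
≤ᵇ-false {m} {n} n<m with m ≤ᵇ n in m≤?n
... | false = refl
... | true  = contradiction (≤ᵇ⇒≤ m n (subst T (sym m≤?n) _)) (<⇒≱ n<m)

<ᵇ-true : ∀ {m n} → m < n → (m <ᵇ n) ≡ true
<ᵇ-true {m} {n} m<n with m <ᵇ n in m<?n
... | true  = refl
... | false = contradiction (<⇒<ᵇ m<n) (subst T m<?n)

listSum : {A : Set} → List A → (A → ℕ) → ℕ
listSum []       f = 0
listSum (x ∷ xs) f = f x + listSum xs f

syntax listSum xs (λ x → e) = ∑[ x ∈ xs ] e

module _ {A : Set} where

  ∑-cong : ∀ xs {f g : A → ℕ} → (∀ x → f x ≡ g x) → listSum xs f ≡ listSum xs g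
  ∑-cong []       f≡g = refl
  ∑-cong (x ∷ xs) f≡g = cong₂ _+_ (f≡g x) (∑-cong xs f≡g)

  ∑-mono-≤ : ∀ xs {f g : A → ℕ} → (∀ x → f x ≤ g x) → listSum xs f ≤ listSum xs g
  ∑-mono-≤ []       f≤g = z≤n
  ∑-mono-≤ (x ∷ xs) f≤g = +-mono-≤ (f≤g x) (∑-mono-≤ xs f≤g)

  ∑-distrib-+ : ∀ xs (f g : A → ℕ) → ∑[ x ∈ xs ] (f x + g x) ≡ listSum xs f + listSum xs g
  ∑-distrib-+ []       f g = refl
  ∑-distrib-+ (x ∷ xs) f g = trans (cong (f x + g x +_) (∑-distrib-+ xs f g))
                                   (interchange (f x) (g x) (listSum xs f) (listSum xs g))

  *-distribˡ-∑ : ∀ c xs (f : A → ℕ) → c * listSum xs f ≡ ∑[ x ∈ xs ] (c * f x)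
  *-distribˡ-∑ c []       f = *-zeroʳ c
  *-distribˡ-∑ c (x ∷ xs) f = trans (*-distribˡ-+ c (f x) (listSum xs f)) (cong (c * f x +_) (*-distribˡ-∑ c xs f))

  ∑-const : ∀ (xs : List A) c → ∑[ x ∈ xs ] c ≡ length xs * c
  ∑-const []       c = refl
  ∑-const (x ∷ xs) c = cong (c +_) (∑-const xs c)

  ∑-++ : ∀ xs ys (f : A → ℕ) → listSum (xs ++ ys) f ≡ listSum xs f + listSum ys f
  ∑-++ []       ys f = refl
  ∑-++ (x ∷ xs) ys f = trans (cong (f x +_) (∑-++ xs ys f)) (sym (+-assoc (f x) _ _))

  ∑-map : ∀ {B : Set} (h : B → A) xs (f : A → ℕ) → listSum (map h xs) f ≡ ∑[ x ∈ xs ] f (h x)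
  ∑-map h []       f = refl
  ∑-map h (x ∷ xs) f = cong (f (h x) +_) (∑-map h xs f)

  ∑-concatMap : ∀ {B : Set} (h : B → List A) xs (f : A → ℕ) →
                listSum (concatMap h xs) f ≡ ∑[ x ∈ xs ] listSum (h x) f
  ∑-concatMap h []       f = refl
  ∑-concatMap h (x ∷ xs) f = trans (∑-++ (h x) (concatMap h xs) f) (cong (listSum (h x) f +_) (∑-concatMap h xs f))

  length-filterᵇ : ∀ (p : A → Bool) xs → length (filterᵇ p xs) ≡ ∑[ x ∈ xs ] 𝟙 (p x)
  length-filterᵇ p []       = refl
  length-filterᵇ p (x ∷ xs) with p x
  ... | true  = cong suc (length-filterᵇ p xs)
  ... | false = length-filterᵇ p xs

  length-filter : ∀ {ℓ} {P : Pred A ℓ} (P? : Decidable P) xs → length (filter P? xs) ≡ ∑[ x ∈ xs ] 𝟙 (does (P? x))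
  length-filter P? []       = refl
  length-filter P? (x ∷ xs) with does (P? x)
  ... | true  = cong suc (length-filter P? xs)
  ... | false = length-filter P? xs

∑-comm : ∀ {A B : Set} (xs : List A) (ys : List B) (f : A → B → ℕ) →
         ∑[ x ∈ xs ] listSum ys (f x) ≡ ∑[ y ∈ ys ] ∑[ x ∈ xs ] f x y
∑-comm []       ys f = sym (trans (∑-const ys 0) (*-zeroʳ (length ys)))
∑-comm (x ∷ xs) ys f = trans (cong (listSum ys (f x) +_) (∑-comm xs ys f)) (sym (∑-distrib-+ ys (f x) _))

rangeSum : ℕ → (ℕ → ℕ) → ℕ
rangeSum zero    f = 0
rangeSum (suc n) f = f 0 + rangeSum n (λ i → f (suc i))

syntax rangeSum n (λ i → e) = ∑[ i < n ] e

∑<-cong : ∀ n {f g : ℕ → ℕ} → (∀ i → i < n → f i ≡ g i) → rangeSum n f ≡ rangeSum n g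
∑<-cong zero    f≡g = refl
∑<-cong (suc n) f≡g = cong₂ _+_ (f≡g 0 z<s) (∑<-cong n (λ i i<n → f≡g (suc i) (s<s i<n)))

∑<-mono-≤ : ∀ n {f g : ℕ → ℕ} → (∀ i → i < n → f i ≤ g i) → rangeSum n f ≤ rangeSum n g
∑<-mono-≤ zero    f≤g = z≤n
∑<-mono-≤ (suc n) f≤g = +-mono-≤ (f≤g 0 z<s) (∑<-mono-≤ n (λ i i<n → f≤g (suc i) (s<s i<n)))

∑<-distrib-+ : ∀ n (f g : ℕ → ℕ) → ∑[ i < n ] (f i + g i) ≡ rangeSum n f + rangeSum n g
∑<-distrib-+ zero    f g = refl
∑<-distrib-+ (suc n) f g = trans (cong (f 0 + g 0 +_) (∑<-distrib-+ n (f ∘ suc) (g ∘ suc)))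
                                 (interchange (f 0) (g 0) _ _)

*-distribˡ-∑< : ∀ c n (f : ℕ → ℕ) → c * rangeSum n f ≡ ∑[ i < n ] (c * f i)
*-distribˡ-∑< c zero    f = *-zeroʳ c
*-distribˡ-∑< c (suc n) f = trans (*-distribˡ-+ c (f 0) _) (cong (c * f 0 +_) (*-distribˡ-∑< c n (λ i → f (suc i))))

∑<-const : ∀ n c → ∑[ i < n ] c ≡ n * c
∑<-const zero    c = refl
∑<-const (suc n) c = cong (c +_) (∑<-const n c)

∑<-+ : ∀ m n (f : ℕ → ℕ) → rangeSum (m + n) f ≡ rangeSum m f + ∑[ i < n ] f (m + i)
∑<-+ zero    n f = refl
∑<-+ (suc m) n f = trans (cong (f 0 +_) (∑<-+ m n (λ i → f (suc i)))) (sym (+-assoc (f 0) _ _))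

∑<-mono-range : ∀ {m n} (f : ℕ → ℕ) → m ≤ n → rangeSum m f ≤ rangeSum n f
∑<-mono-range {m} {n} f m≤n = begin
  rangeSum m f                              ≤⟨ m≤m+n _ _ ⟩
  rangeSum m f + ∑[ i < n ∸ m ] f (m + i)   ≡⟨ ∑<-+ m (n ∸ m) f ⟨
  rangeSum (m + (n ∸ m)) f                  ≡⟨ cong (λ k → rangeSum k f) (m+[n∸m]≡n m≤n) ⟩
  rangeSum n f                              ∎
  where open ≤-Reasoning

∑<-zero : ∀ n {f : ℕ → ℕ} → (∀ i → i < n → f i ≡ 0) → rangeSum n f ≡ 0
∑<-zero n f≡0 = trans (∑<-cong n f≡0) (trans (∑<-const n 0) (*-zeroʳ n))

∑<-support : ∀ {c n X} (f : ℕ → ℕ) → (∀ s → s < c → f s ≡ 0) → (∀ t → n ≤ t → f (c + t) ≡ 0) →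
             c + n ≤ X → rangeSum X f ≡ ∑[ t < n ] f (c + t)
∑<-support {c} {n} {X} f below above c+n≤X = begin
  rangeSum X f                                              ≡⟨ cong (λ Y → rangeSum Y f) (sym c+[n+e]≡X) ⟩
  rangeSum (c + (n + e)) f                                  ≡⟨ ∑<-+ c (n + e) f ⟩
  rangeSum c f + ∑[ t < n + e ] f (c + t)                   ≡⟨ cong₂ _+_ (∑<-zero c below) (∑<-+ n e (λ t → f (c + t))) ⟩
  ∑[ t < n ] f (c + t) + ∑[ t < e ] f (c + (n + t))         ≡⟨ cong (_ +_) (∑<-zero e (λ t _ → above (n + t) (m≤m+n n t))) ⟩
  ∑[ t < n ] f (c + t) + 0                                  ≡⟨ +-identityʳ _ ⟩
  ∑[ t < n ] f (c + t)                                      ∎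
  where
  open ≡-Reasoning
  e = X ∸ (c + n)
  c+[n+e]≡X : c + (n + e) ≡ X
  c+[n+e]≡X = trans (sym (+-assoc c n e)) (m+[n∸m]≡n c+n≤X)

∑<-suc : ∀ n (f : ℕ → ℕ) → rangeSum (suc n) f ≡ rangeSum n f + f n
∑<-suc zero    f = +-comm (f 0) 0
∑<-suc (suc n) f = trans (cong (f 0 +_) (∑<-suc n (f ∘ suc))) (sym (+-assoc (f 0) _ _))

∑<-reverse : ∀ n (g : ℕ → ℕ) → ∑[ t < n ] g (n ∸ t) ≡ ∑[ t < n ] g (suc t)
∑<-reverse zero    g = refl
∑<-reverse (suc n) g = begin
  g (suc n) + ∑[ t < n ] g (n ∸ t)           ≡⟨ cong (g (suc n) +_) (∑<-reverse n g) ⟩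
  g (suc n) + ∑[ t < n ] g (suc t)           ≡⟨ +-comm (g (suc n)) _ ⟩
  ∑[ t < n ] g (suc t) + g (suc n)           ≡⟨ sym (∑<-suc n (g ∘ suc)) ⟩
  ∑[ t < suc n ] g (suc t)                   ∎
  where open ≡-Reasoning

∑<-comm : ∀ m n (f : ℕ → ℕ → ℕ) → ∑[ i < m ] rangeSum n (f i) ≡ ∑[ j < n ] ∑[ i < m ] f i j
∑<-comm zero    n f = sym (∑<-zero n (λ _ _ → refl))
∑<-comm (suc m) n f = trans (cong (rangeSum n (f 0) +_) (∑<-comm m n (λ i → f (suc i))))
                            (sym (∑<-distrib-+ n (f 0) _))

∑-∑<-comm : ∀ {A : Set} (xs : List A) n (f : A → ℕ → ℕ) →
            ∑[ x ∈ xs ] rangeSum n (f x) ≡ ∑[ j < n ] ∑[ x ∈ xs ] f x j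
∑-∑<-comm []       n f = sym (∑<-zero n (λ _ _ → refl))
∑-∑<-comm (x ∷ xs) n f = trans (cong (rangeSum n (f x) +_) (∑-∑<-comm xs n f))
                               (sym (∑<-distrib-+ n (f x) _))

∑-upTo : ∀ n (f : ℕ → ℕ) → listSum (upTo n) f ≡ rangeSum n f
∑-upTo n = go n id
  where
  go : ∀ n (g : ℕ → ℕ) (f : ℕ → ℕ) → listSum (applyUpTo g n) f ≡ ∑[ i < n ] f (g i)
  go zero    g f = refl
  go (suc n) g f = cong (f (g 0) +_) (go n (g ∘ suc) f)

∑-allFin : ∀ n (f : ℕ → ℕ) → ∑[ i ∈ allFin n ] f (toℕ i) ≡ rangeSum n f
∑-allFin m f = go m id id (λ _ → refl)
  where
  go : ∀ n (h : Fin n → Fin m) (g : ℕ → ℕ) → (∀ i → toℕ (h i) ≡ g (toℕ i)) →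
       ∑[ i ∈ tabulate h ] f (toℕ i) ≡ ∑[ i < n ] f (g i)
  go zero    h g h≗g = refl
  go (suc n) h g h≗g = cong₂ _+_ (cong f (h≗g fzero)) (go n (h ∘ fsuc) (g ∘ suc) (h≗g ∘ fsuc))

∑<-𝟙≤ : ∀ n (p : ℕ → Bool) → ∑[ i < n ] 𝟙 (p i) ≤ n
∑<-𝟙≤ n p = ≤-trans (∑<-mono-≤ n (λ i _ → 𝟙≤1 (p i))) (≤-reflexive (trans (∑<-const n 1) (*-identityʳ n)))

∑<-𝟙≡ᵇ : ∀ {n x} → x < n → ∑[ t < n ] 𝟙 (t ≡ᵇ x) ≡ 1
∑<-𝟙≡ᵇ {suc n} {zero}  _         = cong suc (∑<-zero n (λ _ _ → refl))
∑<-𝟙≡ᵇ {suc n} {suc x} (s<s x<n) = ∑<-𝟙≡ᵇ x<n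

∑<-𝟙-unique : ∀ n (p : ℕ → Bool) → (∀ i j → i < n → j < n → T (p i) → T (p j) → i ≡ j) →
              ∑[ i < n ] 𝟙 (p i) ≤ 1
∑<-𝟙-unique zero    p unique = z≤n
∑<-𝟙-unique (suc n) p unique with p 0 in p0
... | false = ∑<-𝟙-unique n (p ∘ suc) (λ i j i<n j<n pi pj → suc-injective (unique _ _ (s<s i<n) (s<s j<n) pi pj))
... | true  = ≤-reflexive (cong suc (∑<-zero n none))
  where
  none : ∀ i → i < n → 𝟙 (p (suc i)) ≡ 0
  none i i<n with p (suc i) in psi
  ... | false = refl
  ... | true  with () ← unique 0 (suc i) z<s (s<s i<n) (subst T (sym p0) _) (subst T (sym psi) _)

2^⌊log₂n⌋≤n : ∀ n → .{{NonZero n}} → 2 ^ ⌊log₂ n ⌋ ≤ n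
2^⌊log₂n⌋≤n n = go n (<-wellFounded n)
  where
  go : ∀ n → .{{NonZero n}} → (rec : Acc _<_ n) → 2 ^ ⌊log2⌋ n rec ≤ n
  go 1             _       = ≤-refl
  go (suc (suc n)) (acc _) = begin
    2 * 2 ^ ⌊log2⌋ (suc ⌊ n /2⌋) _  ≤⟨ *-monoʳ-≤ 2 (go (suc ⌊ n /2⌋) _) ⟩
    2 * suc ⌊ n /2⌋                 ≡⟨ *-distribˡ-+ 2 1 ⌊ n /2⌋ ⟩
    2 + (⌊ n /2⌋ + (⌊ n /2⌋ + 0))   ≤⟨ +-monoʳ-≤ 2 (+-monoʳ-≤ ⌊ n /2⌋ (≤-trans (≤-reflexive (+-identityʳ _)) (⌊n/2⌋≤⌈n/2⌉ n))) ⟩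
    2 + (⌊ n /2⌋ + ⌈ n /2⌉)         ≡⟨ cong (2 +_) (⌊n/2⌋+⌈n/2⌉≡n n) ⟩
    2 + n                           ∎
    where open ≤-Reasoning

2^k≤n⇒k≤⌊log₂n⌋ : ∀ {k n} → 2 ^ k ≤ n → k ≤ ⌊log₂ n ⌋
2^k≤n⇒k≤⌊log₂n⌋ {k} 2^k≤n = ≤-trans (≤-reflexive (sym (⌊log₂[2^n]⌋≡n k))) (⌊log₂⌋-mono-≤ 2^k≤n)

n<2^[1+⌊log₂n⌋] : ∀ n → n < 2 ^ suc ⌊log₂ n ⌋
n<2^[1+⌊log₂n⌋] n = ≰⇒> (λ 2^[1+k]≤n → n≮n ⌊log₂ n ⌋ (2^k≤n⇒k≤⌊log₂n⌋ 2^[1+k]≤n))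

⌈log₂n⌉≤1+⌊log₂n⌋ : ∀ n → ⌈log₂ n ⌉ ≤ suc ⌊log₂ n ⌋
⌈log₂n⌉≤1+⌊log₂n⌋ n = ≤-trans (⌈log₂⌉-mono-≤ (<⇒≤ (n<2^[1+⌊log₂n⌋] n))) (≤-reflexive (⌈log₂2^n⌉≡n _))

-- Collisions of subset sums and legal inputs

multiplicity : ℕ → List ℕ → ℕ
multiplicity x ys = ∑[ y ∈ ys ] 𝟙 (x ≡ᵇ y)

collisions : List ℕ → ℕ
collisions []       = 0
collisions (x ∷ xs) = multiplicity x xs + collisions xs

crossCollisions : List ℕ → List ℕ → ℕ
crossCollisions xs ys = ∑[ x ∈ xs ] multiplicity x ys

collisions-++ : ∀ xs ys → collisions (xs ++ ys) ≡ collisions xs + collisions ys + crossCollisions xs ys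
collisions-++ []       ys = sym (+-identityʳ _)
collisions-++ (x ∷ xs) ys
  rewrite ∑-++ xs ys (λ y → 𝟙 (x ≡ᵇ y)) | collisions-++ xs ys =
    regroup (multiplicity x xs) (multiplicity x ys) (collisions xs) (collisions ys) (crossCollisions xs ys)
  where
  regroup : ∀ a b c d e → a + b + (c + d + e) ≡ a + c + d + (b + e)
  regroup = solve-∀

multiplicity-map : ∀ (f : ℕ → ℕ) {P : ℕ → Set} → (∀ {x y} → P x → P y → f x ≡ f y → x ≡ y) →
                   ∀ {x ys} → P x → All P ys → multiplicity (f x) (map f ys) ≤ multiplicity x ys
multiplicity-map f f-inj {x} px []                = z≤n
multiplicity-map f f-inj {x} px (_∷_ {y} py pys) = +-mono-≤ 𝟙-f≤𝟙 (multiplicity-map f f-inj px pys)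
  where
  𝟙-f≤𝟙 : 𝟙 (f x ≡ᵇ f y) ≤ 𝟙 (x ≡ᵇ y)
  𝟙-f≤𝟙 with f x ≡ᵇ f y in fx≡fy
  ... | false = z≤n
  ... | true  = ≤-reflexive (sym (𝟙-T (≡⇒≡ᵇ x y (f-inj px py (≡ᵇ⇒≡ (f x) (f y) (subst T (sym fx≡fy) _))))))

collisions-map : ∀ (f : ℕ → ℕ) {P : ℕ → Set} → (∀ {x y} → P x → P y → f x ≡ f y → x ≡ y) →
                 ∀ {xs} → All P xs → collisions (map f xs) ≤ collisions xs
collisions-map f f-inj []         = z≤n
collisions-map f f-inj (px ∷ pxs) = +-mono-≤ (multiplicity-map f f-inj px pxs) (collisions-map f f-inj pxs)

∈⇒1≤multiplicity : ∀ {x ys} → x ∈ ys → 1 ≤ multiplicity x ys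
∈⇒1≤multiplicity {x} (here refl)  = ≤-trans (≤-reflexive (sym (𝟙-T (≡⇒≡ᵇ x x refl)))) (m≤m+n _ _)
∈⇒1≤multiplicity     (there x∈ys) = ≤-trans (∈⇒1≤multiplicity x∈ys) (m≤n+m _ _)

#distinct : ℕ → List ℕ → ℕ
#distinct N xs = ∑[ t < N ] 𝟙 (does (t ∈? xs))

length≤distinct+collisions : ∀ {N xs} → All (_< N) xs → length xs ≤ #distinct N xs + collisions xs
length≤distinct+collisions [] = z≤n
length≤distinct+collisions {N} {x ∷ xs} (x<N ∷ xs<N) with x ∈? xs
... | yes x∈xs = begin
  suc (length xs)                             ≤⟨ s≤s (length≤distinct+collisions xs<N) ⟩
  suc (#distinct N xs + collisions xs)        ≡⟨ +-suc (#distinct N xs) (collisions xs) ⟨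
  #distinct N xs + suc (collisions xs)        ≤⟨ +-mono-≤ (∑<-mono-≤ N (λ t _ → 𝟙≤𝟙-∨ˡ (t ≡ᵇ x) _))
                                                          (+-monoˡ-≤ (collisions xs) (∈⇒1≤multiplicity x∈xs)) ⟩
  #distinct N (x ∷ xs) + collisions (x ∷ xs)  ∎
  where open ≤-Reasoning
... | no x∉xs = begin
  suc (length xs)                                          ≤⟨ s≤s (length≤distinct+collisions xs<N) ⟩
  1 + (#distinct N xs + collisions xs)                     ≡⟨ +-assoc 1 (#distinct N xs) _ ⟨
  1 + #distinct N xs + collisions xs                       ≡⟨ cong (λ n → n + #distinct N xs + _) (∑<-𝟙≡ᵇ x<N) ⟨
  ∑[ t < N ] 𝟙 (t ≡ᵇ x) + #distinct N xs + collisions xs   ≡⟨ cong (_+ collisions xs) (∑<-distrib-+ N _ _) ⟨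
  ∑[ t < N ] (𝟙 (t ≡ᵇ x) + 𝟙 (does (t ∈? xs))) + collisions xs
    ≡⟨ cong (_+ collisions xs) (∑<-cong N (λ t _ → sym (𝟙-∨ (t ≡ᵇ x) (does (t ∈? xs)) (not-both t)))) ⟩
  #distinct N (x ∷ xs) + collisions xs                     ≤⟨ +-monoʳ-≤ _ (m≤n+m (collisions xs) (multiplicity x xs)) ⟩
  #distinct N (x ∷ xs) + collisions (x ∷ xs)               ∎
  where
  open ≤-Reasoning
  not-both : ∀ t → ¬ (T (t ≡ᵇ x) × T (does (t ∈? xs)))
  not-both t (t≡x , t∈?xs) with t ∈? xs
  ... | yes t∈xs = x∉xs (subst (_∈ xs) (≡ᵇ⇒≡ t x t≡x) t∈xs)
  ... | no  _    = t∈?xs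

∑-allVecs-suc : ∀ N n (F : Vec (Fin N) (suc n) → ℕ) →
                listSum (allVecs N (suc n)) F ≡ ∑[ a ∈ allFin N ] ∑[ A ∈ allVecs N n ] F (a ∷ A)
∑-allVecs-suc N n F = trans (∑-concatMap (λ a → map (a ∷_) (allVecs N n)) (allFin N) F)
                            (∑-cong (allFin N) (λ a → ∑-map (a ∷_) (allVecs N n) F))

∑-allVecs-const : ∀ N n c → ∑[ A ∈ allVecs N n ] c ≡ N ^ n * c
∑-allVecs-const N zero    c = refl
∑-allVecs-const N (suc n) c = begin
  ∑[ A ∈ allVecs N (suc n) ] c              ≡⟨ ∑-allVecs-suc N n (λ _ → c) ⟩
  ∑[ a ∈ allFin N ] ∑[ A ∈ allVecs N n ] c  ≡⟨ ∑-cong (allFin N) (λ _ → ∑-allVecs-const N n c) ⟩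
  ∑[ a ∈ allFin N ] (N ^ n * c)             ≡⟨ ∑-allFin N (λ _ → N ^ n * c) ⟩
  ∑[ i < N ] (N ^ n * c)                    ≡⟨ ∑<-const N _ ⟩
  N * (N ^ n * c)                           ≡⟨ *-assoc N (N ^ n) c ⟨
  N ^ suc n * c                             ∎
  where open ≡-Reasoning

module _ {N : ℕ} .{{_ : NonZero N}} where

  [m%N+n]%N≡[m+n]%N : ∀ m n → (m % N + n) % N ≡ (m + n) % N
  [m%N+n]%N≡[m+n]%N m n = begin
    (m % N + n) % N            ≡⟨ %-distribˡ-+ (m % N) n N ⟩
    (m % N % N + n % N) % N    ≡⟨ cong (λ v → (v + n % N) % N) (m%n%n≡m%n m N) ⟩
    (m % N + n % N) % N        ≡⟨ %-distribˡ-+ m n N ⟨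
    (m + n) % N                ∎
    where open ≡-Reasoning

  [v+d]%N≡v⇒d≡0 : ∀ {v d} → v < N → d < N → (v + d) % N ≡ v → d ≡ 0
  [v+d]%N≡v⇒d≡0 {v} {d} v<N d<N eq with v + d <? N
  ... | yes v+d<N = +-cancelˡ-≡ v d 0 (trans (sym (m<n⇒m%n≡m v+d<N)) (trans eq (sym (+-identityʳ v))))
  ... | no  v+d≮N = contradiction (+-cancelˡ-≡ v d N v+d≡v+N) (<⇒≢ d<N)
    where
    N≤v+d = ≮⇒≥ v+d≮N
    v+d∸N<N : v + d ∸ N < N
    v+d∸N<N = +-cancelʳ-< _ _ N (subst (_< N + N) (sym (m∸n+n≡m N≤v+d)) (+-mono-< v<N d<N))
    v+d∸N≡v : v + d ∸ N ≡ v
    v+d∸N≡v = trans (sym (m<n⇒m%n≡m v+d∸N<N)) (trans (m≤n⇒[n∸m]%m≡n%m N≤v+d) eq)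
    v+d≡v+N : v + d ≡ v + N
    v+d≡v+N = trans (sym (m∸n+n≡m N≤v+d)) (cong (_+ N) v+d∸N≡v)

  +-%-cancelˡ-≤ : ∀ c {x y} → x ≤ y → y < N → (c + x) % N ≡ (c + y) % N → x ≡ y
  +-%-cancelˡ-≤ c {x} {y} x≤y y<N eq = begin
    x              ≡⟨ +-identityʳ x ⟨
    x + 0          ≡⟨ cong (x +_) d≡0 ⟨
    x + (y ∸ x)    ≡⟨ m+[n∸m]≡n x≤y ⟩
    y              ∎
    where
    open ≡-Reasoning
    d≡0 : y ∸ x ≡ 0
    d≡0 = [v+d]%N≡v⇒d≡0 (m%n<n (c + x) N) (≤-<-trans (m∸n≤m y x) y<N) (begin
      ((c + x) % N + (y ∸ x)) % N   ≡⟨ [m%N+n]%N≡[m+n]%N (c + x) (y ∸ x) ⟩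
      (c + x + (y ∸ x)) % N         ≡⟨ cong (_% N) (trans (+-assoc c x _) (cong (c +_) (m+[n∸m]≡n x≤y))) ⟩
      (c + y) % N                   ≡⟨ eq ⟨
      (c + x) % N                   ∎)

  +-%-cancelˡ : ∀ c {x y} → x < N → y < N → (c + x) % N ≡ (c + y) % N → x ≡ y
  +-%-cancelˡ c {x} {y} x<N y<N eq with ≤-total x y
  ... | inj₁ x≤y = +-%-cancelˡ-≤ c x≤y y<N eq
  ... | inj₂ y≤x = sym (+-%-cancelˡ-≤ c y≤x x<N (sym eq))

  _⊕_ : Fin N → ℕ → ℕ
  a ⊕ s = (toℕ a + s) % N

  subsetSums : ∀ k {m} → Vec (Fin N) (k + m) → List ℕ
  subsetSums zero    A       = 0 ∷ []
  subsetSums (suc k) (a ∷ A) = map (a ⊕_) (subsetSums k A) ++ subsetSums k A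

  subsetSums-< : ∀ k {m} (A : Vec (Fin N) (k + m)) → All (_< N) (subsetSums k A)
  subsetSums-< zero    A       = >-nonZero⁻¹ N ∷ []
  subsetSums-< (suc k) (a ∷ A) = ++⁺ (map⁺ (universal (λ s → m%n<n (toℕ a + s) N) _)) (subsetSums-< k A)

  length-subsetSums : ∀ k {m} (A : Vec (Fin N) (k + m)) → length (subsetSums k A) ≡ 2 ^ k
  length-subsetSums zero    A       = refl
  length-subsetSums (suc k) (a ∷ A) = begin
    length (map (a ⊕_) (subsetSums k A) ++ subsetSums k A)          ≡⟨ length-++ (map (a ⊕_) (subsetSums k A)) ⟩
    length (map (a ⊕_) (subsetSums k A)) + length (subsetSums k A)  ≡⟨ cong (_+ _) (length-map (a ⊕_) (subsetSums k A)) ⟩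
    length (subsetSums k A) + length (subsetSums k A)               ≡⟨ cong₂ _+_ (length-subsetSums k A) (length-subsetSums k A) ⟩
    2 ^ k + 2 ^ k                                                   ≡⟨ cong (2 ^ k +_) (+-identityʳ (2 ^ k)) ⟨
    2 ^ suc k                                                       ∎
    where open ≡-Reasoning

  crossCollisions-translates : ∀ s → ∑[ a ∈ allFin N ] crossCollisions (map (a ⊕_) s) s ≤ length s * length s
  crossCollisions-translates s = begin
    ∑[ a ∈ allFin N ] crossCollisions (map (a ⊕_) s) s
      ≡⟨ ∑-cong (allFin N) (λ a → ∑-map (a ⊕_) s (λ x → multiplicity x s)) ⟩
    ∑[ a ∈ allFin N ] ∑[ x ∈ s ] ∑[ y ∈ s ] 𝟙 ((toℕ a + x) % N ≡ᵇ y)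
      ≡⟨ ∑-allFin N (λ a → ∑[ x ∈ s ] ∑[ y ∈ s ] 𝟙 ((a + x) % N ≡ᵇ y)) ⟩
    ∑[ a < N ] ∑[ x ∈ s ] ∑[ y ∈ s ] 𝟙 ((a + x) % N ≡ᵇ y)
      ≡⟨ ∑-∑<-comm s N (λ x a → ∑[ y ∈ s ] 𝟙 ((a + x) % N ≡ᵇ y)) ⟨
    ∑[ x ∈ s ] ∑[ a < N ] ∑[ y ∈ s ] 𝟙 ((a + x) % N ≡ᵇ y)
      ≡⟨ ∑-cong s (λ x → sym (∑-∑<-comm s N (λ y a → 𝟙 ((a + x) % N ≡ᵇ y)))) ⟩
    ∑[ x ∈ s ] ∑[ y ∈ s ] ∑[ a < N ] 𝟙 ((a + x) % N ≡ᵇ y)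
      ≤⟨ ∑-mono-≤ s (λ x → ∑-mono-≤ s (λ y → ∑<-𝟙-unique N _ (at-most-one-translate x y))) ⟩
    ∑[ x ∈ s ] ∑[ y ∈ s ] 1
      ≡⟨ trans (∑-cong s (λ _ → trans (∑-const s 1) (*-identityʳ _))) (∑-const s (length s)) ⟩
    length s * length s
      ∎
    where
    open ≤-Reasoning
    at-most-one-translate : ∀ x y a b → a < N → b < N → T ((a + x) % N ≡ᵇ y) → T ((b + x) % N ≡ᵇ y) → a ≡ b
    at-most-one-translate x y a b a<N b<N a+x≡y b+x≡y = +-%-cancelˡ x a<N b<N (begin-equality
      (x + a) % N   ≡⟨ cong (_% N) (+-comm x a) ⟩
      (a + x) % N   ≡⟨ ≡ᵇ⇒≡ _ y a+x≡y ⟩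
      y             ≡⟨ ≡ᵇ⇒≡ _ y b+x≡y ⟨
      (b + x) % N   ≡⟨ cong (_% N) (+-comm b x) ⟩
      (x + b) % N   ∎)

  collisions-step : ∀ a s → All (_< N) s → collisions (map (a ⊕_) s ++ s) ≤ 2 * collisions s + crossCollisions (map (a ⊕_) s) s
  collisions-step a s s<N = begin
    collisions (a+s ++ s)                              ≡⟨ collisions-++ a+s s ⟩
    collisions a+s + collisions s + crossCollisions a+s s
      ≤⟨ +-monoˡ-≤ (crossCollisions a+s s) (+-monoˡ-≤ (collisions s) (collisions-map (a ⊕_) (+-%-cancelˡ (toℕ a)) s<N)) ⟩
    collisions s + collisions s + crossCollisions a+s s
      ≡⟨ cong (λ c → collisions s + c + crossCollisions a+s s) (+-identityʳ (collisions s)) ⟨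
    2 * collisions s + crossCollisions a+s s           ∎
    where
    open ≤-Reasoning
    a+s = map (a ⊕_) s

  ∑-collisions-subsetSums-suc : ∀ k m →
    ∑[ A ∈ allVecs N (suc k + m) ] collisions (subsetSums (suc k) A)
      ≤ N * (2 * ∑[ A ∈ allVecs N (k + m) ] collisions (subsetSums k A)) + N ^ (k + m) * (2 ^ k * 2 ^ k)
  ∑-collisions-subsetSums-suc k m = begin
    ∑[ A ∈ allVecs N (suc k + m) ] collisions (subsetSums (suc k) A)
      ≡⟨ ∑-allVecs-suc N (k + m) _ ⟩
    ∑[ a ∈ allFin N ] ∑[ A ∈ V ] collisions (map (a ⊕_) (ss A) ++ ss A)
      ≤⟨ ∑-mono-≤ (allFin N) (λ a → ∑-mono-≤ V (λ A → collisions-step a (ss A) (subsetSums-< k A))) ⟩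
    ∑[ a ∈ allFin N ] ∑[ A ∈ V ] (2 * collisions (ss A) + cross a A)
      ≡⟨ ∑-cong (allFin N) (λ a → ∑-distrib-+ V _ (cross a)) ⟩
    ∑[ a ∈ allFin N ] (∑[ A ∈ V ] (2 * collisions (ss A)) + ∑[ A ∈ V ] cross a A)
      ≡⟨ ∑-distrib-+ (allFin N) _ _ ⟩
    ∑[ a ∈ allFin N ] ∑[ A ∈ V ] (2 * collisions (ss A)) + ∑[ a ∈ allFin N ] ∑[ A ∈ V ] cross a A
      ≡⟨ cong₂ _+_ (trans (∑-allFin N _) (trans (∑<-const N _) (cong (N *_) (sym (*-distribˡ-∑ 2 V _)))))
                   (∑-comm (allFin N) V cross) ⟩
    N * (2 * P) + ∑[ A ∈ V ] ∑[ a ∈ allFin N ] cross a A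
      ≤⟨ +-monoʳ-≤ (N * (2 * P)) (∑-mono-≤ V (λ A → crossCollisions-translates (ss A))) ⟩
    N * (2 * P) + ∑[ A ∈ V ] (length (ss A) * length (ss A))
      ≡⟨ cong (N * (2 * P) +_) (trans (∑-cong V (λ A → cong₂ _*_ (length-subsetSums k A) (length-subsetSums k A)))
                                      (∑-allVecs-const N (k + m) _)) ⟩
    N * (2 * P) + N ^ (k + m) * (2 ^ k * 2 ^ k)
      ∎
    where
    open ≤-Reasoning
    V = allVecs N (k + m)
    ss : Vec (Fin N) (k + m) → List ℕ
    ss = subsetSums k
    cross : Fin N → Vec (Fin N) (k + m) → ℕ
    cross a A = crossCollisions (map (a ⊕_) (ss A)) (ss A)
    P = ∑[ A ∈ V ] collisions (ss A)

  collisions-subsetSums : ∀ k m →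
    2 * N * ∑[ A ∈ allVecs N (k + m) ] collisions (subsetSums k A) ≤ 2 ^ k * 2 ^ k * N ^ (k + m)
  collisions-subsetSums zero    m
    rewrite ∑-const (allVecs N m) 0 | *-zeroʳ (length (allVecs N m)) | *-zeroʳ (2 * N) = z≤n
  collisions-subsetSums (suc k) m = begin
    2 * N * P′                                  ≤⟨ *-monoʳ-≤ (2 * N) (∑-collisions-subsetSums-suc k m) ⟩
    2 * N * (N * (2 * P) + Q * (F * F))         ≡⟨ distribute N P Q F ⟩
    2 * N * (2 * N * P) + 2 * N * (Q * (F * F)) ≤⟨ +-monoˡ-≤ _ (*-monoʳ-≤ (2 * N) (collisions-subsetSums k m)) ⟩
    2 * N * (F * F * Q) + 2 * N * (Q * (F * F)) ≡⟨ collect N Q F ⟩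
    2 * F * (2 * F) * (N * Q)                   ∎
    where
    open ≤-Reasoning
    P′ = ∑[ A ∈ allVecs N (suc k + m) ] collisions (subsetSums (suc k) A)
    P = ∑[ A ∈ allVecs N (k + m) ] collisions (subsetSums k A)
    Q = N ^ (k + m)
    F = 2 ^ k
    distribute : ∀ n p q f → 2 * n * (n * (2 * p) + q * (f * f)) ≡ 2 * n * (2 * n * p) + 2 * n * (q * (f * f))
    distribute = solve-∀
    collect : ∀ n q f → 2 * n * (f * f * q) + 2 * n * (q * (f * f)) ≡ 2 * f * (2 * f) * (n * q)
    collect = solve-∀

subsetSum-⊥ : ∀ {N n} (A : Vec (Fin N) n) → subsetSum A ⊥ ≡ 0
subsetSum-⊥ []      = refl
subsetSum-⊥ (a ∷ A) = subsetSum-⊥ A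

-- For N = suc M the modulus suc (N ∸ 1) of Solves is literally suc M.
∈-subsetSums⇒solvable : ∀ {M} k {m} (A : Vec (Fin (suc M)) (k + m)) {s} → s ∈ subsetSums k A →
                        ∃ λ B → subsetSum A B % suc M ≡ s
∈-subsetSums⇒solvable {M} zero A (here refl) = ⊥ , cong (_% suc M) (subsetSum-⊥ A)
∈-subsetSums⇒solvable {M} (suc k) (a ∷ A) s∈ with ∈-++⁻ (map (a ⊕_) (subsetSums k A)) s∈
... | inj₂ s∈A with B , B↦s ← ∈-subsetSums⇒solvable k A s∈A = outside ∷ B , B↦s
... | inj₁ s∈a+A with s′ , s′∈A , refl ← ∈-map⁻ (a ⊕_) s∈a+A
                 with B , B↦s′ ← ∈-subsetSums⇒solvable k A s′∈A = inside ∷ B , (begin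
  (toℕ a + subsetSum A B) % suc M          ≡⟨ cong (_% suc M) (+-comm (toℕ a) _) ⟩
  (subsetSum A B + toℕ a) % suc M          ≡⟨ [m%N+n]%N≡[m+n]%N (subsetSum A B) (toℕ a) ⟨
  (subsetSum A B % suc M + toℕ a) % suc M  ≡⟨ cong (λ v → (v + toℕ a) % suc M) B↦s′ ⟩
  (s′ + toℕ a) % suc M                     ≡⟨ cong (_% suc M) (+-comm s′ (toℕ a)) ⟩
  (toℕ a + s′) % suc M                     ∎)
  where open ≡-Reasoning

#legal≡∑ : ∀ N → #legal N ≡ ∑[ A ∈ allVecs N (r N) ] ∑[ t ∈ allFin N ] 𝟙 (does (Legal? A t))
#legal≡∑ N = trans (length-filter _ (allInputs N))
                   (trans (∑-concatMap (λ A → map (A ,_) (allFin N)) (allVecs N (r N)) _)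
                          (∑-cong (allVecs N (r N)) (λ A → ∑-map (A ,_) (allFin N) _)))

#distinct-subsetSums≤#legal : ∀ {M} (A : Input (suc M)) →
  #distinct (suc M) (subsetSums ⌊log₂ suc M ⌋ A) ≤ ∑[ t ∈ allFin (suc M) ] 𝟙 (does (Legal? A t))
#distinct-subsetSums≤#legal {M} A = begin
  ∑[ t < suc M ] 𝟙 (does (t ∈? ss))                ≡⟨ ∑-allFin (suc M) (λ t → 𝟙 (does (t ∈? ss))) ⟨
  ∑[ t ∈ allFin (suc M) ] 𝟙 (does (toℕ t ∈? ss))   ≤⟨ ∑-mono-≤ (allFin (suc M)) (λ t → 𝟙-does-mono (toℕ t ∈? ss) (Legal? A t)
                                                                                   (∈-subsetSums⇒solvable ⌊log₂ suc M ⌋ A)) ⟩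
  ∑[ t ∈ allFin (suc M) ] 𝟙 (does (Legal? A t))    ∎
  where
  open ≤-Reasoning
  ss = subsetSums ⌊log₂ suc M ⌋ A

legal-lower-bound : ∀ M → suc M ^ suc (r (suc M)) ≤ 4 * #legal (suc M)
legal-lower-bound M = begin
  N * N ^ r N                 ≤⟨ *-monoˡ-≤ (N ^ r N) (<⇒≤ (n<2^[1+⌊log₂n⌋] N)) ⟩
  2 * 2 ^ k * N ^ r N         ≡⟨ *-assoc 2 (2 ^ k) _ ⟩
  2 * (2 ^ k * N ^ r N)       ≡⟨ cong (2 *_) (*-comm (2 ^ k) _) ⟩
  2 * (N ^ r N * 2 ^ k)       ≤⟨ *-monoʳ-≤ 2 N^r*2^k≤2Λ ⟩
  2 * (2 * Λ)                 ≡⟨ *-assoc 2 2 Λ ⟨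
  4 * Λ                       ≤⟨ *-monoʳ-≤ 4 Λ≤#legal ⟩
  4 * #legal N                ∎
  where
  open ≤-Reasoning
  N = suc M
  k = ⌊log₂ N ⌋
  V = allVecs N (r N)
  ss = subsetSums k {4}
  Λ = ∑[ A ∈ V ] #distinct N (ss A)
  P = ∑[ A ∈ V ] collisions (ss A)
  Λ≤#legal : Λ ≤ #legal N
  Λ≤#legal = ≤-trans (∑-mono-≤ V #distinct-subsetSums≤#legal) (≤-reflexive (sym (#legal≡∑ N)))
  N^r*2^k≤Λ+P : N ^ r N * 2 ^ k ≤ Λ + P
  N^r*2^k≤Λ+P = begin
    N ^ r N * 2 ^ k                        ≡⟨ ∑-allVecs-const N (r N) (2 ^ k) ⟨
    ∑[ A ∈ V ] (2 ^ k)                     ≡⟨ ∑-cong V (λ A → length-subsetSums k A) ⟨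
    ∑[ A ∈ V ] length (ss A)               ≤⟨ ∑-mono-≤ V (λ A → length≤distinct+collisions (subsetSums-< k A)) ⟩
    ∑[ A ∈ V ] (#distinct N (ss A) + collisions (ss A))
                                           ≡⟨ ∑-distrib-+ V _ _ ⟩
    Λ + P                                  ∎
  2NP≤N*N^r*2^k : 2 * N * P ≤ N * (N ^ r N * 2 ^ k)
  2NP≤N*N^r*2^k = begin
    2 * N * P                   ≤⟨ collisions-subsetSums k 4 ⟩
    2 ^ k * 2 ^ k * N ^ r N     ≤⟨ *-monoˡ-≤ (N ^ r N) (*-monoˡ-≤ (2 ^ k) (2^⌊log₂n⌋≤n N)) ⟩
    N * 2 ^ k * N ^ r N         ≡⟨ *-assoc N (2 ^ k) (N ^ r N) ⟩
    N * (2 ^ k * N ^ r N)       ≡⟨ cong (N *_) (*-comm (2 ^ k) (N ^ r N)) ⟩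
    N * (N ^ r N * 2 ^ k)       ∎
  N^r*2^k≤2Λ : N ^ r N * 2 ^ k ≤ 2 * Λ
  N^r*2^k≤2Λ = *-cancelˡ-≤ N (+-cancelʳ-≤ (N * X) (N * X) (N * (2 * Λ)) (begin
    N * X + N * X               ≡⟨ cong (N * X +_) (+-identityʳ (N * X)) ⟨
    2 * (N * X)                 ≡⟨ *-assoc 2 N X ⟨
    2 * N * X                   ≤⟨ *-monoʳ-≤ (2 * N) N^r*2^k≤Λ+P ⟩
    2 * N * (Λ + P)             ≡⟨ *-distribˡ-+ (2 * N) Λ P ⟩
    2 * N * Λ + 2 * N * P       ≤⟨ +-monoʳ-≤ (2 * N * Λ) 2NP≤N*N^r*2^k ⟩
    2 * N * Λ + N * X           ≡⟨ cong (_+ N * X) (trans (cong (_* Λ) (*-comm 2 N)) (*-assoc N 2 Λ)) ⟩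
    N * (2 * Λ) + N * X         ∎))
    where X = N ^ r N * 2 ^ k

-- Inputs with many answers

threshold-bound : ∀ {N K s} → s ≤ N → s * K ≤ N + N * K * 𝟙 (N ≤ᵇ s * K)
threshold-bound {N} {K} {s} s≤N with N ≤ᵇ s * K in N≤?sK
... | true  = ≤-trans (*-monoˡ-≤ K s≤N) (≤-trans (≤-reflexive (sym (*-identityʳ (N * K)))) (m≤n+m _ N))
... | false = ≤-trans (<⇒≤ (≰⇒> (λ N≤sK → subst T N≤?sK (≤⇒≤ᵇ N≤sK)))) (m≤m+n N _)

size : ℕ → (ℕ → Bool) → ℕ
size N U = ∑[ t < N ] 𝟙 (U t)

Within : ℕ → (ℕ → Bool) → Set
Within N U = ∀ {t} → N ≤ t → U t ≡ false

#dense : SubsetSumAlg → (N K : ℕ) → ℕ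
#dense S N K = ∑[ A ∈ allVecs N (r N) ] 𝟙 (N ≤ᵇ size N (inS S N A) * K)

inS-within : ∀ S N A → Within N (inS S N A)
inS-within S N A {t} N≤t with t <? N
... | yes t<N = contradiction N≤t (<⇒≱ t<N)
... | no  _   = refl

inS-toℕ : ∀ S N A (t : Fin N) → inS S N A (toℕ t) ≡ is-just (S N A t)
inS-toℕ S N A t with toℕ t <? N
... | yes t<N = cong (λ t′ → is-just (S N A t′)) (fromℕ<-toℕ t t<N)
... | no  t≮N = contradiction (toℕ<n t) t≮N

#solved≤∑size : ∀ S N → #solved S N ≤ ∑[ A ∈ allVecs N (r N) ] size N (inS S N A)
#solved≤∑size S N = begin
  #solved S N                              ≤⟨ List.length-filter _ (filterᵇ answered (allInputs N)) ⟩
  length (filterᵇ answered (allInputs N))  ≡⟨ length-filterᵇ answered (allInputs N) ⟩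
  ∑[ x ∈ allInputs N ] 𝟙 (answered x)      ≡⟨ ∑-concatMap (λ A → map (A ,_) (allFin N)) V _ ⟩
  ∑[ A ∈ V ] ∑[ x ∈ map (A ,_) (allFin N) ] 𝟙 (answered x)
    ≡⟨ ∑-cong V (λ A → trans (∑-map (A ,_) (allFin N) _)
                             (trans (∑-cong (allFin N) (λ t → cong 𝟙 (sym (inS-toℕ S N A t))))
                                    (∑-allFin N (λ t → 𝟙 (inS S N A t))))) ⟩
  ∑[ A ∈ V ] size N (inS S N A)            ∎
  where
  open ≤-Reasoning
  V = allVecs N (r N)
  answered : Σ (Input N) (λ _ → Fin N) → Bool
  answered (A , t) = is-just (S N A t)

many-dense-inputs : ∀ S M ℓ → #legal (suc M) ≤ #solved S (suc M) * ℓ →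
                    suc M ^ r (suc M) ≤ #dense S (suc M) (8 * ℓ) * (8 * ℓ)
many-dense-inputs S M ℓ legal≤solved*ℓ = *-cancelˡ-≤ N (+-cancelˡ-≤ (N * N ^ r N) _ _ (begin
  N * N ^ r N + N * N ^ r N               ≡⟨ cong (N * N ^ r N +_) (+-identityʳ (N * N ^ r N)) ⟨
  2 * (N * N ^ r N)                       ≤⟨ *-monoʳ-≤ 2 (legal-lower-bound M) ⟩
  2 * (4 * #legal N)                      ≤⟨ *-monoʳ-≤ 2 (*-monoʳ-≤ 4 legal≤solved*ℓ) ⟩
  2 * (4 * (#solved S N * ℓ))             ≤⟨ *-monoʳ-≤ 2 (*-monoʳ-≤ 4 (*-monoˡ-≤ ℓ (#solved≤∑size S N))) ⟩
  2 * (4 * (Σsize * ℓ))                   ≡⟨ regroup Σsize ℓ ⟩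
  K * Σsize                               ≡⟨ *-distribˡ-∑ K V _ ⟩
  ∑[ A ∈ V ] (K * size N (inS S N A))     ≤⟨ ∑-mono-≤ V (λ A → ≤-trans (≤-reflexive (*-comm K _))
                                                                       (threshold-bound (∑<-𝟙≤ N (inS S N A)))) ⟩
  ∑[ A ∈ V ] (N + N * K * dense A)        ≡⟨ ∑-distrib-+ V _ _ ⟩
  ∑[ A ∈ V ] N + ∑[ A ∈ V ] (N * K * dense A)
                                          ≡⟨ cong₂ _+_ (trans (∑-allVecs-const N (r N) N) (*-comm (N ^ r N) N))
                                                       (trans (sym (*-distribˡ-∑ (N * K) V dense)) (*-assoc N K _)) ⟩
  N * N ^ r N + N * (K * #dense S N K)    ≡⟨ cong (λ x → N * N ^ r N + N * x) (*-comm K _) ⟩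
  N * N ^ r N + N * (#dense S N K * K)    ∎))
  where
  open ≤-Reasoning
  N = suc M
  K = 8 * ℓ
  V = allVecs N (r N)
  Σsize = ∑[ A ∈ V ] size N (inS S N A)
  dense : Input N → ℕ
  dense A = 𝟙 (N ≤ᵇ size N (inS S N A) * K)
  regroup : ∀ s l → 2 * (4 * (s * l)) ≡ 8 * l * s
  regroup = solve-∀

-- Shift overlaps of a dense set

shiftOverlap : ℕ → (ℕ → Bool) → ℕ → ℕ
shiftOverlap N U d = ∑[ t < N ] 𝟙 (U t ∧ U (t + d))

amgm : ∀ w a → 2 * a * w ≤ w * w + a * a
amgm w a with ≤-total w a
... | inj₁ w≤a rewrite sym (m+[n∸m]≡n w≤a) = ≤-trans (m≤m+n _ _) (≤-reflexive (square w (a ∸ w)))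
  where
  square : ∀ w d → 2 * (w + d) * w + d * d ≡ w * w + (w + d) * (w + d)
  square = solve-∀
... | inj₂ a≤w rewrite sym (m+[n∸m]≡n a≤w) = ≤-trans (m≤m+n _ _) (≤-reflexive (square a (w ∸ a)))
  where
  square : ∀ a d → 2 * a * (a + d) + d * d ≡ (a + d) * (a + d) + a * a
  square = solve-∀

∑<-amgm : ∀ n (w : ℕ → ℕ) a → 2 * a * rangeSum n w ≤ ∑[ s < n ] (w s * w s) + n * (a * a)
∑<-amgm n w a = begin
  2 * a * rangeSum n w                          ≡⟨ *-distribˡ-∑< (2 * a) n w ⟩
  ∑[ s < n ] (2 * a * w s)                      ≤⟨ ∑<-mono-≤ n (λ s _ → amgm (w s) a) ⟩
  ∑[ s < n ] (w s * w s + a * a)                ≡⟨ ∑<-distrib-+ n _ _ ⟩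
  ∑[ s < n ] (w s * w s) + ∑[ s < n ] (a * a)   ≡⟨ cong (_ +_) (∑<-const n (a * a)) ⟩
  ∑[ s < n ] (w s * w s) + n * (a * a)          ∎
  where open ≤-Reasoning

window-arithmetic : ∀ {u τ E X N K a} → .{{NonZero u}} → 2 * a * (u * τ) ≤ u * (E + (τ + E)) + X * (a * a) →
                    X ≤ N + N → N ≤ τ * K → 4 * K * a ≤ u → 2 ≤ a → a * τ ≤ 2 * E
window-arithmetic {u} {τ} {E} {X} {N} {K} {a} cauchy-schwarz X≤2N N≤τK 4Ka≤u 2≤a =
  *-cancelˡ-≤ 4 (+-cancelʳ-≤ (4 * τ) (4 * (a * τ)) (4 * (2 * E)) (begin
    4 * (a * τ) + 4 * τ       ≤⟨ +-monoʳ-≤ (4 * (a * τ)) (*-monoˡ-≤ τ (*-monoʳ-≤ 2 2≤a)) ⟩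
    4 * (a * τ) + 2 * a * τ   ≡⟨ 4aτ+2aτ≡6aτ a τ ⟩
    6 * a * τ                 ≤⟨ 6aτ≤4[E+τ+E] ⟩
    4 * (E + (τ + E))         ≡⟨ 4[E+τ+E]≡8E+4τ E τ ⟩
    4 * (2 * E) + 4 * τ       ∎))
  where
  open ≤-Reasoning
  4aτ+2aτ≡6aτ : ∀ a τ → 4 * (a * τ) + 2 * a * τ ≡ 6 * a * τ
  4aτ+2aτ≡6aτ = solve-∀
  4[E+τ+E]≡8E+4τ : ∀ E τ → 4 * (E + (τ + E)) ≡ 4 * (2 * E) + 4 * τ
  4[E+τ+E]≡8E+4τ = solve-∀
  4[2τK]a²≡2aτ[4Ka] : ∀ τ K a → 4 * ((τ * K + τ * K) * (a * a)) ≡ 2 * a * τ * (4 * K * a)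
  4[2τK]a²≡2aτ[4Ka] = solve-∀
  6aτu+2aτu≡4[2auτ] : ∀ a τ u → 6 * a * τ * u + 2 * a * τ * u ≡ 4 * (2 * a * (u * τ))
  6aτu+2aτu≡4[2auτ] = solve-∀
  4[u[E+τ+E]]≡4[E+τ+E]u : ∀ u E τ → 4 * (u * (E + (τ + E))) ≡ 4 * (E + (τ + E)) * u
  4[u[E+τ+E]]≡4[E+τ+E]u = solve-∀
  4Xa²≤2aτu : 4 * (X * (a * a)) ≤ 2 * a * τ * u
  4Xa²≤2aτu = begin
    4 * (X * (a * a))               ≤⟨ *-monoʳ-≤ 4 (*-monoˡ-≤ (a * a) (≤-trans X≤2N (+-mono-≤ N≤τK N≤τK))) ⟩
    4 * ((τ * K + τ * K) * (a * a)) ≡⟨ 4[2τK]a²≡2aτ[4Ka] τ K a ⟩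
    2 * a * τ * (4 * K * a)         ≤⟨ *-monoʳ-≤ (2 * a * τ) 4Ka≤u ⟩
    2 * a * τ * u                   ∎
  6aτ≤4[E+τ+E] : 6 * a * τ ≤ 4 * (E + (τ + E))
  6aτ≤4[E+τ+E] = *-cancelʳ-≤ (6 * a * τ) (4 * (E + (τ + E))) u (+-cancelʳ-≤ (2 * a * τ * u) _ _ (begin
    6 * a * τ * u + 2 * a * τ * u                 ≡⟨ 6aτu+2aτu≡4[2auτ] a τ u ⟩
    4 * (2 * a * (u * τ))                         ≤⟨ *-monoʳ-≤ 4 cauchy-schwarz ⟩
    4 * (u * (E + (τ + E)) + X * (a * a))         ≡⟨ *-distribˡ-+ 4 (u * (E + (τ + E))) _ ⟩
    4 * (u * (E + (τ + E))) + 4 * (X * (a * a))   ≤⟨ +-mono-≤ (≤-reflexive (4[u[E+τ+E]]≡4[E+τ+E]u u E τ)) 4Xa²≤2aτu ⟩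
    4 * (E + (τ + E)) * u + 2 * a * τ * u         ∎))

module Windows {N : ℕ} {U : ℕ → Bool} (within : Within N U) (q L : ℕ) where

  hit : ℕ → ℕ → ℕ
  hit i s = 𝟙 ((i * q ≤ᵇ s) ∧ U (s ∸ i * q))

  window : ℕ → ℕ
  window s = ∑[ i < suc L ] hit i s

  X : ℕ
  X = N + L * q

  ∑overlaps : ℕ
  ∑overlaps = ∑[ j < L ] shiftOverlap N U (suc j * q)

  hit-< : ∀ i {s} → s < i * q → hit i s ≡ 0
  hit-< i s<iq rewrite ≤ᵇ-false s<iq = refl

  hit-+ : ∀ i t → hit i (i * q + t) ≡ 𝟙 (U t)
  hit-+ i t rewrite ≤ᵇ-true (m≤m+n (i * q) t) | m+n∸m≡n (i * q) t = refl

  ∑-hit : ∀ i → i ≤ L → ∑[ s < X ] hit i s ≡ size N U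
  ∑-hit i i≤L = trans (∑<-support (hit i) (λ s → hit-< i) (λ t N≤t → trans (hit-+ i t) (cong 𝟙 (within N≤t))) iq+N≤X)
                      (∑<-cong N (λ t _ → hit-+ i t))
    where
    iq+N≤X : i * q + N ≤ X
    iq+N≤X = ≤-trans (≤-reflexive (+-comm (i * q) N)) (+-monoʳ-≤ N (*-monoˡ-≤ q i≤L))

  correlation : ℕ → ℕ → ℕ
  correlation i i′ = ∑[ s < X ] (hit i s * hit i′ s)

  correlation-comm : ∀ i i′ → correlation i i′ ≡ correlation i′ i
  correlation-comm i i′ = ∑<-cong X (λ s _ → *-comm (hit i s) (hit i′ s))

  correlation-+ : ∀ i d → i + d ≤ L → correlation i (i + d) ≡ shiftOverlap N U (d * q)
  correlation-+ i d i+d≤L = trans (∑<-support _ below above c+N≤X) (∑<-cong N (λ t _ → at t))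
    where
    c = (i + d) * q
    c+N≤X : c + N ≤ X
    c+N≤X = ≤-trans (≤-reflexive (+-comm c N)) (+-monoʳ-≤ N (*-monoˡ-≤ q i+d≤L))
    below : ∀ s → s < c → hit i s * hit (i + d) s ≡ 0
    below s s<c = trans (cong (hit i s *_) (hit-< (i + d) s<c)) (*-zeroʳ (hit i s))
    shift : ∀ t → c + t ≡ i * q + (d * q + t)
    shift t = trans (cong (_+ t) (*-distribʳ-+ q i d)) (+-assoc (i * q) (d * q) t)
    at : ∀ t → hit i (c + t) * hit (i + d) (c + t) ≡ 𝟙 (U t ∧ U (t + d * q))
    at t = begin
      hit i (c + t) * hit (i + d) (c + t)    ≡⟨ cong₂ _*_ (trans (cong (hit i) (shift t)) (hit-+ i (d * q + t))) (hit-+ (i + d) t) ⟩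
      𝟙 (U (d * q + t)) * 𝟙 (U t)            ≡⟨ *-comm (𝟙 (U (d * q + t))) _ ⟩
      𝟙 (U t) * 𝟙 (U (d * q + t))            ≡⟨ 𝟙-∧ (U t) _ ⟨
      𝟙 (U t ∧ U (d * q + t))                ≡⟨ cong (λ s → 𝟙 (U t ∧ U s)) (+-comm (d * q) t) ⟩
      𝟙 (U t ∧ U (t + d * q))                ∎
      where open ≡-Reasoning
    above : ∀ t → N ≤ t → hit i (c + t) * hit (i + d) (c + t) ≡ 0
    above t N≤t = trans (at t) (cong (λ b → 𝟙 (b ∧ U (t + d * q))) (within N≤t))

  ∑-window : ∑[ s < X ] window s ≡ suc L * size N U
  ∑-window = begin
    ∑[ s < X ] ∑[ i < suc L ] hit i s     ≡⟨ ∑<-comm X (suc L) (λ s i → hit i s) ⟩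
    ∑[ i < suc L ] ∑[ s < X ] hit i s     ≡⟨ ∑<-cong (suc L) (λ i i<1+L → ∑-hit i (≤-pred i<1+L)) ⟩
    ∑[ i < suc L ] size N U               ≡⟨ ∑<-const (suc L) _ ⟩
    suc L * size N U                      ∎
    where open ≡-Reasoning

  ∑-window² : ∑[ s < X ] (window s * window s) ≡ ∑[ i < suc L ] ∑[ i′ < suc L ] correlation i i′
  ∑-window² = begin
    ∑[ s < X ] (window s * window s)
      ≡⟨ ∑<-cong X (λ s _ → square s) ⟩
    ∑[ s < X ] ∑[ i < suc L ] ∑[ i′ < suc L ] (hit i s * hit i′ s)
      ≡⟨ ∑<-comm X (suc L) (λ s i → ∑[ i′ < suc L ] (hit i s * hit i′ s)) ⟩
    ∑[ i < suc L ] ∑[ s < X ] ∑[ i′ < suc L ] (hit i s * hit i′ s)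
      ≡⟨ ∑<-cong (suc L) (λ i _ → ∑<-comm X (suc L) (λ s i′ → hit i s * hit i′ s)) ⟩
    ∑[ i < suc L ] ∑[ i′ < suc L ] correlation i i′
      ∎
    where
    open ≡-Reasoning
    square : ∀ s → window s * window s ≡ ∑[ i < suc L ] ∑[ i′ < suc L ] (hit i s * hit i′ s)
    square s = trans (*-distribˡ-∑< (window s) (suc L) (λ i → hit i s))
                     (∑<-cong (suc L) (λ i _ → trans (*-comm (window s) (hit i s))
                                                     (*-distribˡ-∑< (hit i s) (suc L) (λ i′ → hit i′ s))))

  ∑-correlation≤ : ∀ i → i ≤ L → ∑[ i′ < suc L ] correlation i i′ ≤ ∑overlaps + (size N U + ∑overlaps)
  ∑-correlation≤ i i≤L = begin
    ∑[ i′ < suc L ] correlation i i′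
      ≡⟨ cong (λ n → rangeSum n (correlation i)) (sym i+[1+L∸i]≡1+L) ⟩
    ∑[ i′ < i + suc (L ∸ i) ] correlation i i′
      ≡⟨ ∑<-+ i (suc (L ∸ i)) (correlation i) ⟩
    ∑[ i′ < i ] correlation i i′ + (correlation i (i + 0) + ∑[ d < L ∸ i ] correlation i (i + suc d))
      ≤⟨ +-mono-≤ before (+-mono-≤ diagonal after) ⟩
    ∑overlaps + (size N U + ∑overlaps)
      ∎
    where
    open ≤-Reasoning
    i+[1+L∸i]≡1+L : i + suc (L ∸ i) ≡ suc L
    i+[1+L∸i]≡1+L = trans (+-suc i (L ∸ i)) (cong suc (m+[n∸m]≡n i≤L))
    below-diagonal : ∀ {i′} → i′ < i → correlation i i′ ≡ shiftOverlap N U ((i ∸ i′) * q)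
    below-diagonal {i′} i′<i = begin-equality
      correlation i i′                   ≡⟨ correlation-comm i i′ ⟩
      correlation i′ i                   ≡⟨ cong (correlation i′) i′+[i∸i′]≡i ⟨
      correlation i′ (i′ + (i ∸ i′))     ≡⟨ correlation-+ i′ (i ∸ i′) (≤-trans (≤-reflexive i′+[i∸i′]≡i) i≤L) ⟩
      shiftOverlap N U ((i ∸ i′) * q)    ∎
      where i′+[i∸i′]≡i = m+[n∸m]≡n (<⇒≤ i′<i)
    before : ∑[ i′ < i ] correlation i i′ ≤ ∑overlaps
    before = begin
      ∑[ i′ < i ] correlation i i′                         ≡⟨ ∑<-cong i (λ i′ → below-diagonal) ⟩
      ∑[ i′ < i ] shiftOverlap N U ((i ∸ i′) * q)          ≡⟨ ∑<-reverse i (λ d → shiftOverlap N U (d * q)) ⟩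
      ∑[ j < i ] shiftOverlap N U (suc j * q)              ≤⟨ ∑<-mono-range _ i≤L ⟩
      ∑overlaps                                            ∎
    diagonal : correlation i (i + 0) ≤ size N U
    diagonal = ≤-trans (≤-reflexive (correlation-+ i 0 (≤-trans (≤-reflexive (+-identityʳ i)) i≤L)))
                       (∑<-mono-≤ N (λ t _ → 𝟙-∧≤ˡ (U t) _))
    after : ∑[ d < L ∸ i ] correlation i (i + suc d) ≤ ∑overlaps
    after = begin
      ∑[ d < L ∸ i ] correlation i (i + suc d)             ≡⟨ ∑<-cong (L ∸ i) (λ d d<L∸i → correlation-+ i (suc d) (i+1+d≤L d<L∸i)) ⟩
      ∑[ d < L ∸ i ] shiftOverlap N U (suc d * q)          ≤⟨ ∑<-mono-range _ (m∸n≤m L i) ⟩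
      ∑overlaps                                            ∎
      where
      i+1+d≤L : ∀ {d} → d < L ∸ i → i + suc d ≤ L
      i+1+d≤L {d} d<L∸i = ≤-trans (+-monoʳ-≤ i d<L∸i) (≤-reflexive (m+[n∸m]≡n i≤L))

  ∑overlaps-lower-bound : ∀ {K a} → L * q < N → N ≤ size N U * K → 4 * K * a ≤ L → 2 ≤ a →
                          a * size N U ≤ 2 * ∑overlaps
  ∑overlaps-lower-bound {K} {a} Lq<N N≤τK 4Ka≤L 2≤a =
    window-arithmetic {u} {τ} {E} {X} {N} {K} {a}
      weighted-cauchy-schwarz (+-monoʳ-≤ N (<⇒≤ Lq<N)) N≤τK (≤-trans 4Ka≤L (n≤1+n L)) 2≤a
    where
    open ≤-Reasoning
    u = suc L
    τ = size N U
    E = ∑overlaps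
    weighted-cauchy-schwarz : 2 * a * (u * τ) ≤ u * (E + (τ + E)) + X * (a * a)
    weighted-cauchy-schwarz = begin
      2 * a * (u * τ)                                       ≡⟨ cong (2 * a *_) ∑-window ⟨
      2 * a * ∑[ s < X ] window s                           ≤⟨ ∑<-amgm X window a ⟩
      ∑[ s < X ] (window s * window s) + X * (a * a)        ≡⟨ cong (_+ X * (a * a)) ∑-window² ⟩
      ∑[ i < u ] ∑[ i′ < u ] correlation i i′ + X * (a * a) ≤⟨ +-monoˡ-≤ _ (∑<-mono-≤ u (λ i i<u → ∑-correlation≤ i (≤-pred i<u))) ⟩
      ∑[ i < u ] (E + (τ + E)) + X * (a * a)                ≡⟨ cong (_+ X * (a * a)) (∑<-const u _) ⟩
      u * (E + (τ + E)) + X * (a * a)                       ∎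

-- The matchings f¹ and f²

f¹-or-f²-pairs : ∀ N d t → t + suc d < N → f¹ N (suc d) t ≡ just (t + suc d) ⊎ f² N (suc d) t ≡ just (t + suc d)
f¹-or-f²-pairs N d t t+d<N with t % (2 * suc d) <ᵇ suc d
... | true  rewrite <ᵇ-true t+d<N = inj₁ refl
... | false rewrite <ᵇ-true t+d<N = inj₂ refl

#intersection≡∑ : ∀ N f U → #intersection N f U ≡ ∑[ t < N ] 𝟙 (U t ∧ maybe U false (f t))
#intersection≡∑ N f U = trans (length-filterᵇ _ (upTo N)) (∑-upTo N _)

#intersection≤N : ∀ N f U → #intersection N f U ≤ N
#intersection≤N N f U = subst (_≤ N) (sym (#intersection≡∑ N f U)) (∑<-𝟙≤ N _)

shiftOverlap≤intersections : ∀ {N U} → Within N U → ∀ d →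
  shiftOverlap N U (suc d) ≤ #intersection N (f¹ N (suc d)) U + #intersection N (f² N (suc d)) U
shiftOverlap≤intersections {N} {U} within d = begin
  ∑[ t < N ] 𝟙 (U t ∧ U (t + suc d))                        ≤⟨ ∑<-mono-≤ N (λ t _ → paired t) ⟩
  ∑[ t < N ] (matched (f¹ N (suc d)) t + matched (f² N (suc d)) t)
                                                            ≡⟨ ∑<-distrib-+ N _ _ ⟩
  ∑[ t < N ] matched (f¹ N (suc d)) t + ∑[ t < N ] matched (f² N (suc d)) t
                                                            ≡⟨ cong₂ _+_ (#intersection≡∑ N (f¹ N (suc d)) U) (#intersection≡∑ N (f² N (suc d)) U) ⟨
  #intersection N (f¹ N (suc d)) U + #intersection N (f² N (suc d)) U ∎
  where
  open ≤-Reasoning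
  matched : Matching → ℕ → ℕ
  matched f t = 𝟙 (U t ∧ maybe U false (f t))
  paired : ∀ t → 𝟙 (U t ∧ U (t + suc d)) ≤ matched (f¹ N (suc d)) t + matched (f² N (suc d)) t
  paired t with U (t + suc d) in partner
  ... | false = ≤-trans (≤-reflexive (cong 𝟙 (∧-zeroʳ (U t)))) z≤n
  ... | true  with t + suc d <? N
  ...   | no  t+d≮N = contradiction (trans (sym partner) (within (≮⇒≥ t+d≮N))) λ ()
  ...   | yes t+d<N with f¹-or-f²-pairs N d t t+d<N
  ...     | inj₁ f¹t≡t+d rewrite f¹t≡t+d | partner = m≤m+n _ _
  ...     | inj₂ f²t≡t+d rewrite f²t≡t+d | partner = m≤n+m _ _

-- The shifts j q, 1 ≤ j ≤ L, of the paper are indexed as suc j * q with j < L.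
#goodShifts : ℕ → (ℕ → Bool) → ℕ → ℕ → ℕ
#goodShifts N U q L =
  ∑[ j < L ] (𝟙 (N ≤ᵇ #intersection N (f¹ N (suc j * q)) U * L) + 𝟙 (N ≤ᵇ #intersection N (f² N (suc j * q)) U * L))

∑intersections≤ : ∀ N U q L → .{{NonZero L}} →
  ∑[ j < L ] (#intersection N (f¹ N (suc j * q)) U + #intersection N (f² N (suc j * q)) U) ≤ N * (#goodShifts N U q L + 2)
∑intersections≤ N U q L = *-cancelˡ-≤ L (begin
  L * ∑[ j < L ] (I¹ j + I² j)                    ≡⟨ *-distribˡ-∑< L L _ ⟩
  ∑[ j < L ] (L * (I¹ j + I² j))                  ≤⟨ ∑<-mono-≤ L (λ j _ → split j) ⟩
  ∑[ j < L ] (N * L * (g¹ j + g² j) + 2 * N)      ≡⟨ ∑<-distrib-+ L _ _ ⟩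
  ∑[ j < L ] (N * L * (g¹ j + g² j)) + ∑[ j < L ] (2 * N)
                                                  ≡⟨ cong₂ _+_ (sym (*-distribˡ-∑< (N * L) L _)) (∑<-const L (2 * N)) ⟩
  N * L * #goodShifts N U q L + L * (2 * N)       ≡⟨ nlg+l[2n]≡l[n[g+2]] N L (#goodShifts N U q L) ⟩
  L * (N * (#goodShifts N U q L + 2))             ∎)
  where
  open ≤-Reasoning
  I¹ I² g¹ g² : ℕ → ℕ
  I¹ j = #intersection N (f¹ N (suc j * q)) U
  I² j = #intersection N (f² N (suc j * q)) U
  g¹ j = 𝟙 (N ≤ᵇ I¹ j * L)
  g² j = 𝟙 (N ≤ᵇ I² j * L)
  [n+nlx]+[n+nly]≡nl[x+y]+2n : ∀ n l x y → (n + n * l * x) + (n + n * l * y) ≡ n * l * (x + y) + 2 * n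
  [n+nlx]+[n+nly]≡nl[x+y]+2n = solve-∀
  split : ∀ j → L * (I¹ j + I² j) ≤ N * L * (g¹ j + g² j) + 2 * N
  split j = begin
    L * (I¹ j + I² j)                     ≡⟨ trans (*-distribˡ-+ L (I¹ j) _) (cong₂ _+_ (*-comm L (I¹ j)) (*-comm L (I² j))) ⟩
    I¹ j * L + I² j * L                   ≤⟨ +-mono-≤ (threshold-bound (#intersection≤N N (f¹ N (suc j * q)) U))
                                                      (threshold-bound (#intersection≤N N (f² N (suc j * q)) U)) ⟩
    (N + N * L * g¹ j) + (N + N * L * g² j) ≡⟨ [n+nlx]+[n+nly]≡nl[x+y]+2n N L (g¹ j) (g² j) ⟩
    N * L * (g¹ j + g² j) + 2 * N         ∎
  nlg+l[2n]≡l[n[g+2]] : ∀ n l g → n * l * g + l * (2 * n) ≡ l * (n * (g + 2))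
  nlg+l[2n]≡l[n[g+2]] = solve-∀

many-good-shifts : ∀ {N U} → Within N U → ∀ q′ L K →
                   L * suc q′ < N → N ≤ size N U * K → 16 * K * K * (K + 1) ≤ L → 2 * K ≤ #goodShifts N U (suc q′) L
many-good-shifts {N} {U} _ q′ L zero Lq<N N≤τ*0 _ =
  contradiction (≤-trans N≤τ*0 (≤-reflexive (*-zeroʳ (size N U)))) (<⇒≱ (≤-<-trans z≤n Lq<N))
many-good-shifts {N} {U} within q′ L K@(suc _) Lq<N N≤τK 16K²[K+1]≤L =
  +-cancelʳ-≤ 2 (2 * K) G (*-cancelˡ-≤ (2 * K) a≤2K[G+2])
  where
  open ≤-Reasoning
  open Windows within (suc q′) L using (∑overlaps; ∑overlaps-lower-bound)
  4k[2k[2k+2]]≡16kk[k+1] : ∀ k → 4 * k * (2 * k * (2 * k + 2)) ≡ 16 * k * k * (k + 1)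
  4k[2k[2k+2]]≡16kk[k+1] = solve-∀
  a[τk]≡k[aτ] : ∀ a τ k → a * (τ * k) ≡ k * (a * τ)
  a[τk]≡k[aτ] = solve-∀
  k[2[n[g+2]]]≡n[2k[g+2]] : ∀ k n g → k * (2 * (n * (g + 2))) ≡ n * (2 * k * (g + 2))
  k[2[n[g+2]]]≡n[2k[g+2]] = solve-∀
  τ = size N U
  G = #goodShifts N U (suc q′) L
  a = 2 * K * (2 * K + 2)
  instance
    L≢0 : NonZero L
    L≢0 = >-nonZero (≤-trans (s≤s z≤n) 16K²[K+1]≤L)
    N≢0 : NonZero N
    N≢0 = >-nonZero (≤-<-trans z≤n Lq<N)
  2≤a : 2 ≤ a
  2≤a = ≤-trans (m≤n+m 2 (2 * K)) (m≤n*m (2 * K + 2) (2 * K))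
  aτ≤2N[G+2] : a * τ ≤ 2 * (N * (G + 2))
  aτ≤2N[G+2] = begin
    a * τ                  ≤⟨ ∑overlaps-lower-bound Lq<N N≤τK (≤-trans (≤-reflexive (4k[2k[2k+2]]≡16kk[k+1] K)) 16K²[K+1]≤L) 2≤a ⟩
    2 * ∑overlaps          ≤⟨ *-monoʳ-≤ 2 (∑<-mono-≤ L (λ j _ → shiftOverlap≤intersections within (q′ + j * suc q′))) ⟩
    2 * ∑[ j < L ] (#intersection N (f¹ N (suc j * suc q′)) U + #intersection N (f² N (suc j * suc q′)) U)
                           ≤⟨ *-monoʳ-≤ 2 (∑intersections≤ N U (suc q′) L) ⟩
    2 * (N * (G + 2))      ∎
  a≤2K[G+2] : a ≤ 2 * K * (G + 2)
  a≤2K[G+2] = *-cancelˡ-≤ N (begin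
    N * a                     ≡⟨ *-comm N a ⟩
    a * N                     ≤⟨ *-monoʳ-≤ a N≤τK ⟩
    a * (τ * K)               ≡⟨ a[τk]≡k[aτ] a τ K ⟩
    K * (a * τ)               ≤⟨ *-monoʳ-≤ K aτ≤2N[G+2] ⟩
    K * (2 * (N * (G + 2)))   ≡⟨ k[2[n[g+2]]]≡n[2k[g+2]] K N G ⟩
    N * (2 * K * (G + 2))     ∎)

-- Averaging over the inputs

pigeonhole : ∀ n (v : ℕ → ℕ) {X} → 0 < X → X ≤ ∑[ j < n ] v j → ∃ λ j → j < n × X ≤ v j * n
pigeonhole zero    v 0<X X≤0 = contradiction X≤0 (<⇒≱ 0<X)
pigeonhole (suc n) v {X} 0<X X≤∑v with anyUpTo? (λ j → X ≤? v j * suc n) (suc n)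
... | yes found = found
... | no  none  = contradiction (+-cancelˡ-≤ (suc n * X) (suc n) 0 (begin
  suc n * X + suc n                     ≤⟨ +-monoˡ-≤ (suc n) (*-monoʳ-≤ (suc n) X≤∑v) ⟩
  suc n * rangeSum (suc n) v + suc n    ≡⟨ cong₂ _+_ (*-distribˡ-∑< (suc n) (suc n) v)
                                                     (trans (sym (*-identityʳ (suc n))) (sym (∑<-const (suc n) 1))) ⟩
  ∑[ j < suc n ] (suc n * v j) + ∑[ j < suc n ] 1
                                        ≡⟨ ∑<-distrib-+ (suc n) (λ j → suc n * v j) (λ _ → 1) ⟨
  ∑[ j < suc n ] (suc n * v j + 1)      ≤⟨ ∑<-mono-≤ (suc n) (λ j j<n → below j j<n) ⟩
  ∑[ j < suc n ] X                      ≡⟨ ∑<-const (suc n) X ⟩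
  suc n * X                             ≡⟨ +-identityʳ _ ⟨
  suc n * X + 0                         ∎)) λ ()
  where
  open ≤-Reasoning
  below : ∀ j → j < suc n → suc n * v j + 1 ≤ X
  below j j<n = ≤-trans (≤-reflexive (trans (+-comm _ 1) (cong suc (*-comm (suc n) (v j)))))
                        (≰⇒> (λ X≤ → none (j , j<n , X≤)))

2*x≤m+n⇒x≤m⊎x≤n : ∀ {x m n} → 2 * x ≤ m + n → x ≤ m ⊎ x ≤ n
2*x≤m+n⇒x≤m⊎x≤n {x} {m} {n} 2x≤m+n with x ≤? m | x ≤? n
... | yes x≤m | _       = inj₁ x≤m
... | no  _   | yes x≤n = inj₂ x≤n
... | no  x≰m | no  x≰n = contradiction 2x≤m+n (<⇒≱ (begin-strict
  m + n         <⟨ +-mono-< (≰⇒> x≰m) (≰⇒> x≰n) ⟩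
  x + x         ≡⟨ cong (x +_) (+-identityʳ x) ⟨
  2 * x         ∎))
  where open ≤-Reasoning

∑#goodShifts≡∑#goodA : ∀ S N q L →
  ∑[ A ∈ allVecs N (r N) ] #goodShifts N (inS S N A) q L
    ≡ ∑[ j < L ] (#goodA S N (f¹ N (suc j * q)) L + #goodA S N (f² N (suc j * q)) L)
∑#goodShifts≡∑#goodA S N q L = trans (∑-∑<-comm V L _) (∑<-cong L (λ j _ →
  trans (∑-distrib-+ V _ _) (sym (cong₂ _+_ (length-filterᵇ _ V) (length-filterᵇ _ V)))))
  where V = allVecs N (r N)

good-matching-exists : ∀ S M q′ ℓ L → let N = suc M; q = suc q′; K = 8 * ℓ in
  #legal N ≤ #solved S N * ℓ → L * q < N → 16 * K * K * (K + 1) ≤ L →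
  ∃ λ j → j < L × (Good S N (f¹ N (suc j * q)) L ⊎ Good S N (f² N (suc j * q)) L)
good-matching-exists S M q′ ℓ L legal≤solved*ℓ Lq<N 16K²[K+1]≤L =
  let j , j<L , 2N^r≤g*L = pigeonhole L (λ j → g¹ j + g² j) (*-monoʳ-< 2 (m^n>0 N (r N))) 2N^r≤∑g
  in  j , j<L , 2*x≤m+n⇒x≤m⊎x≤n (≤-trans 2N^r≤g*L (≤-reflexive (*-distribʳ-+ L (g¹ j) (g² j))))
  where
  open ≤-Reasoning
  N = suc M
  q = suc q′
  K = 8 * ℓ
  V = allVecs N (r N)
  g¹ g² : ℕ → ℕ
  g¹ j = #goodA S N (f¹ N (suc j * q)) L
  g² j = #goodA S N (f² N (suc j * q)) L
  dense⇒good : ∀ A → 2 * K * 𝟙 (N ≤ᵇ size N (inS S N A) * K) ≤ #goodShifts N (inS S N A) q L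
  dense⇒good A with N ≤ᵇ size N (inS S N A) * K in dense
  ... | false = ≤-trans (≤-reflexive (*-zeroʳ (2 * K))) z≤n
  ... | true  = ≤-trans (≤-reflexive (*-identityʳ (2 * K)))
                        (many-good-shifts (inS-within S N A) q′ L K Lq<N (≤ᵇ⇒≤ N _ (subst T (sym dense) _)) 16K²[K+1]≤L)
  2N^r≤∑g : 2 * N ^ r N ≤ ∑[ j < L ] (g¹ j + g² j)
  2N^r≤∑g = begin
    2 * N ^ r N                                            ≤⟨ *-monoʳ-≤ 2 (many-dense-inputs S M ℓ legal≤solved*ℓ) ⟩
    2 * (#dense S N K * K)                                 ≡⟨ cong (2 *_) (*-comm (#dense S N K) K) ⟩
    2 * (K * #dense S N K)                                 ≡⟨ *-assoc 2 K _ ⟨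
    2 * K * #dense S N K                                   ≡⟨ *-distribˡ-∑ (2 * K) V _ ⟩
    ∑[ A ∈ V ] (2 * K * 𝟙 (N ≤ᵇ size N (inS S N A) * K))   ≤⟨ ∑-mono-≤ V dense⇒good ⟩
    ∑[ A ∈ V ] #goodShifts N (inS S N A) q L               ≡⟨ ∑#goodShifts≡∑#goodA S N q L ⟩
    ∑[ j < L ] (g¹ j + g² j)                               ∎

polylog-bound : ∀ cs N → 2 ^ 9216 ≤ N → let K = 8 * ⌈log₂ N ⌉ ^ cs in 16 * K * K * (K + 1) ≤ ⌊log₂ N ⌋ ^ suc (6 * cs)
polylog-bound cs N 2^9216≤N = begin
  16 * K * K * (K + 1)               ≤⟨ *-mono-≤ (*-mono-≤ (*-monoʳ-≤ 16 K≤8Z) K≤8Z) (+-mono-≤ K≤8Z 1≤Z) ⟩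
  16 * (8 * Z) * (8 * Z) * (8 * Z + Z) ≡⟨ 16[8z][8z][8z+z]≡9216z³ Z ⟩
  9216 * (Z * Z * Z)                 ≤⟨ *-monoˡ-≤ (Z * Z * Z) 9216≤n ⟩
  n * (Z * Z * Z)                    ≡⟨ cong (n *_) n^[6cs]≡Z³ ⟨
  n ^ suc (6 * cs)                   ∎
  where
  open ≤-Reasoning
  n = ⌊log₂ N ⌋
  K = 8 * ⌈log₂ N ⌉ ^ cs
  Z = n ^ (2 * cs)
  16[8z][8z][8z+z]≡9216z³ : ∀ z → 16 * (8 * z) * (8 * z) * (8 * z + z) ≡ 9216 * (z * z * z)
  16[8z][8z][8z+z]≡9216z³ = solve-∀
  -- through a lemma with a variable exponent, so that Agda never normalises 2 ^ 9216
  9216≤n : 9216 ≤ n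
  9216≤n = 2^k≤n⇒k≤⌊log₂n⌋ 2^9216≤N
  1≤Z : 1 ≤ Z
  1≤Z = ≤-trans (≤-reflexive (sym (^-zeroˡ (2 * cs)))) (^-monoˡ-≤ (2 * cs) (≤-trans (s≤s z≤n) 9216≤n))
  ⌈log₂N⌉≤n² : ⌈log₂ N ⌉ ≤ n ^ 2
  ⌈log₂N⌉≤n² = begin
    ⌈log₂ N ⌉     ≤⟨ ⌈log₂n⌉≤1+⌊log₂n⌋ N ⟩
    1 + n         ≤⟨ +-monoˡ-≤ n (≤-trans (s≤s z≤n) 9216≤n) ⟩
    n + n         ≡⟨ cong (n +_) (+-identityʳ n) ⟨
    2 * n         ≤⟨ *-monoˡ-≤ n (≤-trans (s≤s (s≤s z≤n)) 9216≤n) ⟩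
    n * n         ≡⟨ cong (n *_) (*-identityʳ n) ⟨
    n ^ 2         ∎
  K≤8Z : K ≤ 8 * Z
  K≤8Z = *-monoʳ-≤ 8 (≤-trans (^-monoˡ-≤ cs ⌈log₂N⌉≤n²) (≤-reflexive (^-*-assoc n 2 cs)))
  n^[6cs]≡Z³ : n ^ (6 * cs) ≡ Z * Z * Z
  n^[6cs]≡Z³ = begin-equality
    n ^ (6 * cs)             ≡⟨ cong (n ^_) (6c≡2c*3 cs) ⟩
    n ^ (2 * cs * 3)         ≡⟨ ^-*-assoc n (2 * cs) 3 ⟨
    Z * (Z * (Z * 1))        ≡⟨ z[z[z*1]]≡zzz Z ⟩
    Z * Z * Z                ∎
    where
    6c≡2c*3 : ∀ c → 6 * c ≡ 2 * c * 3
    6c≡2c*3 = solve-∀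
    z[z[z*1]]≡zzz : ∀ z → z * (z * (z * 1)) ≡ z * z * z
    z[z[z*1]]≡zzz = solve-∀

lemma4p5 : (cs : ℕ) → 1 ≤ cs → (S : SubsetSumAlg) → Correct S →
    (∀ N → 2 ≤ N → SolvesFraction S ⌈log₂_⌉ cs N) →
    ∃[ cm ] ∃[ N₀ ] (∀ N → N₀ ≤ N → ∀ q → 1 ≤ q → q * ⌊log₂ N ⌋ ^ cm < N →
      ∃[ j ] (1 ≤ j × j ≤ ⌊log₂ N ⌋ ^ cm ×
        (Good S N (f¹ N (j * q)) (⌊log₂ N ⌋ ^ cm) ⊎ Good S N (f² N (j * q)) (⌊log₂ N ⌋ ^ cm))))
lemma4p5 cs _ S _ solves = suc (6 * cs) , 2 ^ 9216 , λ where
  zero    N₀≤0 _        _ _    → contradiction N₀≤0 (<⇒≱ (m^n>0 2 9216))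
  (suc M) N₀≤N (suc q′) _ qL<N →
    let N = suc M
        L = ⌊log₂ N ⌋ ^ suc (6 * cs)
        2≤N = ≤-trans (^-monoʳ-≤ 2 {1} {9216} (s≤s z≤n)) N₀≤N
        j , j<L , good = good-matching-exists S M q′ (⌈log₂ N ⌉ ^ cs) L (solves N 2≤N)
                                              (subst (_< N) (*-comm (suc q′) L) qL<N) (polylog-bound cs N N₀≤N)
    in  suc j , s≤s z≤n , j<L , good
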